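{- For $n\ge1$ let $SCS(n)$ be the number of self-complementary score sequences of length $n$, $SS(n)$ the number of strong score sequences of length $n$, and $SSCS(n)$ the number of score sequences of length $n$ that are both strong and self-complementary; set $SCS(0)=1$. Then for all $n\ge1$, $$SSCS(n)=SCS(n)-\sum_{i=1}^{\lfloor n/2\rfloor} SS(i)\,SCS(n-2i).$$
   Context: A score sequence of length $n\ge1$ is a sequence $(s_1,\dots,s_n)$ of non-negative integers with $s_1\le\cdots\le s_n$, $\sum_{i=1}^r s_i\ge\binom r2$ for $1\le r<n$ and $\sum_{i=1}^n s_i=\binom n2$ (equivalently, the nondecreasing out-degree sequence of a tournament on $n$ vertices). It is strong if $\sum_{i=1}^r s_i>\binom r2$ for all $1\le r<n$, and self-complementary if $s_{n+1-i}=n-1-s_i$ for all $1\le i\le\lfloor n/2\rfloor$ (so the length-1 sequence $(0)$ is self-complementary and $SCS(1)=1$). The empty sequence is regarded as the unique self-complementary score sequence of length $0$, i.e. $SCS(0)=1$. -}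

module Defs where

open import Data.Nat using (ℕ; zero; suc; _+_; _*_; _∸_; _≤_; _<_; _≟_; _≤?_; _<?_; _/_)
open import Data.Nat.Combinatorics using (_C_)
open import Data.Nat.ListAction using (sum)
open import Data.List using (List; []; _∷_; [_]; length; take; map; filter; upTo; concatMap)
open import Data.List.Relation.Unary.All using (All; all?)
open import Data.List.Relation.Unary.Linked using (Linked; linked?)
open import Data.Product using (_×_)
open import Relation.Nullary using (Dec)
open import Relation.Nullary.Decidable using (_×-dec_; _→-dec_)
open import Relation.Binary.PropositionalEquality using (_≡_)

-- 0-indexed access to a list (default 0 out of range; only used in range)
_!_ : List ℕ → ℕ → ℕ
[] ! _ = 0
(x ∷ xs) ! zero = x
(x ∷ xs) ! suc i = xs ! i

range1 : ℕ → List ℕ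
range1 n = map suc (upTo (n ∸ 1))

IsScoreSeq : ℕ → List ℕ → Set
IsScoreSeq n s =
  (length s ≡ n) × Linked _≤_ s ×
  All (λ r → r C 2 ≤ sum (take r s)) (range1 n) × (sum s ≡ n C 2)

IsStrong : ℕ → List ℕ → Set
IsStrong n s = All (λ r → r C 2 < sum (take r s)) (range1 n)

-- self-complementary: s_{n+1-i} = n-1-s_i for 1 ≤ i ≤ ⌊n/2⌋
-- (written 0-indexed: for 0 ≤ j < ⌊n/2⌋, s[n-1-j] = (n-1) - s[j])
IsSelfComp : ℕ → List ℕ → Set
IsSelfComp n s = All (λ j → s ! (n ∸ 1 ∸ j) ≡ (n ∸ 1) ∸ (s ! j)) (upTo (n / 2))

isScoreSeq? : ∀ n s → Dec (IsScoreSeq n s)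
isScoreSeq? n s =
  (length s ≟ n) ×-dec linked? _≤?_ s ×-dec
  all? (λ r → r C 2 ≤? sum (take r s)) (range1 n) ×-dec (sum s ≟ n C 2)

isStrong? : ∀ n s → Dec (IsStrong n s)
isStrong? n s = all? (λ r → r C 2 <? sum (take r s)) (range1 n)

isSelfComp? : ∀ n s → Dec (IsSelfComp n s)
isSelfComp? n s = all? (λ j → s ! (n ∸ 1 ∸ j) ≟ (n ∸ 1) ∸ (s ! j)) (upTo (n / 2))

lists : ℕ → ℕ → List (List ℕ)
lists B zero = [ [] ]
lists B (suc n) = concatMap (λ x → map (x ∷_) (lists B n)) (upTo (suc B))

-- Every score sequence of length n has entries ≤ C(n,2) (they are
-- non-negative and sum to C(n,2)), so lists (n C 2) n contains all of them,
-- each exactly once.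
candidates : ℕ → List (List ℕ)
candidates n = lists (n C 2) n

SCS : ℕ → ℕ
SCS n = length (filter (λ s → isScoreSeq? n s ×-dec isSelfComp? n s) (candidates n))

SS : ℕ → ℕ
SS n = length (filter (λ s → isScoreSeq? n s ×-dec isStrong? n s) (candidates n))

SSCS : ℕ → ℕ
SSCS n = length (filter (λ s → isScoreSeq? n s ×-dec isStrong? n s ×-dec isSelfComp? n s) (candidates n))

-- A self-complementary score sequence s of length n is either strong or has a least
-- r ≥ 1 with s₁ + ⋯ + s_r = C(r,2).  Self-complementarity makes the Landau slack
-- (s₁ + ⋯ + s_r) - C(r,2) symmetric under r ↦ n - r, so this least r is at most n/2,
-- and it is the only length ≤ n/2 at which s has a strong score sequence as a prefix.
-- Cutting s after r and before the last r entries writes s = t ++ m ++ w, where t is a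
-- strong score sequence of length r, w is determined by t (complemented and reversed),
-- and m - r is a self-complementary score sequence of length n - 2r; conversely every
-- such pair (t, m) glues to a self-complementary score sequence of length n.

module Submission where

open import Defs
open import Data.Nat using (ℕ; zero; suc; _+_; _*_; _∸_; _≤_; _<_; _/_; z≤n; s≤s; _≟_; _≤?_; _<?_)
open import Data.Nat.Properties
open import Data.Nat.Combinatorics using (_C_; nCk+nC[k+1]≡[n+1]C[k+1]; nC1≡n)
open import Data.Nat.DivMod using (m/n*n≤m; m*n/n≡m; /-monoˡ-≤)
open import Data.Nat.ListAction using (sum)
open import Data.Nat.ListAction.Properties using (sum-++)
open import Data.Nat.Tactic.RingSolver using (solve-∀)
open import Data.List using (List; []; _∷_; length; take; map; filter; upTo; concatMap; concat; _++_; applyUpTo)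
open import Data.List.Properties using (≡-dec; ∷-injective; map-++; map-cong; map-∘; take-all; length-++; length-map; length-applyUpTo)
open import Data.List.Relation.Unary.All using (All; []; _∷_; all?)
open import Data.List.Relation.Unary.All.Properties using (map⁻; map⁺; applyUpTo⁻; applyUpTo⁺₁; ++⁺)
open import Data.List.Relation.Unary.Linked using (Linked; []; [-]; _∷_)
open import Data.Product using (_×_; _,_; proj₁; ∃)
open import Data.Sum using (inj₁; inj₂)
open import Data.Empty using (⊥-elim)
open import Function using (_∘_; id; _⇔_; mk⇔; Equivalence)
open import Relation.Nullary using (Dec; yes; no; ¬_)
open import Relation.Nullary.Decidable using (_×-dec_)
open import Relation.Binary.Definitions using (tri<; tri≈; tri>)
open import Relation.Binary.PropositionalEquality

𝟙 : ∀ {p} {P : Set p} → Dec P → ℕ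
𝟙 (yes _) = 1
𝟙 (no _)  = 0

𝟙-yes : ∀ {p} {P : Set p} → P → (d : Dec P) → 𝟙 d ≡ 1
𝟙-yes _ (yes _) = refl
𝟙-yes p (no ¬p) = ⊥-elim (¬p p)

𝟙-no : ∀ {p} {P : Set p} → ¬ P → (d : Dec P) → 𝟙 d ≡ 0
𝟙-no ¬p (yes p) = ⊥-elim (¬p p)
𝟙-no _  (no _)  = refl

𝟙-cong : ∀ {p q} {P : Set p} {Q : Set q} → P ⇔ Q → (d : Dec P) (e : Dec Q) → 𝟙 d ≡ 𝟙 e
𝟙-cong P⇔Q (yes p) e = sym (𝟙-yes (Equivalence.to P⇔Q p) e)
𝟙-cong P⇔Q (no ¬p) e = sym (𝟙-no (¬p ∘ Equivalence.from P⇔Q) e)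

𝟙-× : ∀ {p q} {P : Set p} {Q : Set q} (d : Dec P) (e : Dec Q) → 𝟙 (d ×-dec e) ≡ 𝟙 d * 𝟙 e
𝟙-× (yes _) (yes _) = refl
𝟙-× (yes _) (no _)  = refl
𝟙-× (no _)  _       = refl

∑ : {A : Set} → (A → ℕ) → List A → ℕ
∑ F L = sum (map F L)

module _ {A : Set} where

  length-filter≡∑𝟙 : {P : A → Set} (P? : ∀ x → Dec (P x)) (L : List A) →
    length (filter P? L) ≡ ∑ (𝟙 ∘ P?) L
  length-filter≡∑𝟙 P? [] = refl
  length-filter≡∑𝟙 P? (x ∷ L) with P? x
  ... | yes _ = cong suc (length-filter≡∑𝟙 P? L)
  ... | no _  = length-filter≡∑𝟙 P? L

  ∑-cong : {F G : A → ℕ} → (∀ x → F x ≡ G x) → (L : List A) → ∑ F L ≡ ∑ G L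
  ∑-cong F≗G L = cong sum (map-cong F≗G L)

  ∑-++ : (F : A → ℕ) (L M : List A) → ∑ F (L ++ M) ≡ ∑ F L + ∑ F M
  ∑-++ F L M = trans (cong sum (map-++ F L M)) (sum-++ (map F L) (map F M))

  ∑-zero : (L : List A) → ∑ (λ _ → 0) L ≡ 0
  ∑-zero []      = refl
  ∑-zero (_ ∷ L) = ∑-zero L

  ∑-+ : (F G : A → ℕ) (L : List A) → ∑ (λ x → F x + G x) L ≡ ∑ F L + ∑ G L
  ∑-+ F G []      = refl
  ∑-+ F G (x ∷ L) = trans (cong (F x + G x +_) (∑-+ F G L)) (+-+-comm (F x) (G x) (∑ F L) (∑ G L))
    where
    +-+-comm : ∀ a b c d → a + b + (c + d) ≡ a + c + (b + d)
    +-+-comm = solve-∀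

  ∑-*ˡ : (c : ℕ) (F : A → ℕ) (L : List A) → ∑ (λ x → c * F x) L ≡ c * ∑ F L
  ∑-*ˡ c F []      = sym (*-zeroʳ c)
  ∑-*ˡ c F (x ∷ L) = trans (cong (c * F x +_) (∑-*ˡ c F L)) (sym (*-distribˡ-+ c (F x) _))

  ∑-*ʳ : (c : ℕ) (F : A → ℕ) (L : List A) → ∑ (λ x → F x * c) L ≡ ∑ F L * c
  ∑-*ʳ c F L = trans (∑-cong (λ x → *-comm (F x) c) L) (trans (∑-*ˡ c F L) (*-comm c _))

module _ {A B : Set} where

  ∑-map : (F : B → ℕ) (g : A → B) (L : List A) → ∑ F (map g L) ≡ ∑ (F ∘ g) L
  ∑-map F g L = cong sum (sym (map-∘ L))

  ∑-concatMap : (F : B → ℕ) (G : A → List B) (L : List A) →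
    ∑ F (concatMap G L) ≡ ∑ (λ x → ∑ F (G x)) L
  ∑-concatMap F G []      = refl
  ∑-concatMap F G (x ∷ L) =
    trans (∑-++ F (G x) (concat (map G L))) (cong (∑ F (G x) +_) (∑-concatMap F G L))

∑< : ℕ → (ℕ → ℕ) → ℕ
∑< zero    f = 0
∑< (suc m) f = ∑< m f + f m

syntax ∑< m (λ j → e) = ∑[ j < m ] e

∑<-cong : {f g : ℕ → ℕ} (m : ℕ) → (∀ j → j < m → f j ≡ g j) → ∑< m f ≡ ∑< m g
∑<-cong zero    f≗g = refl
∑<-cong (suc m) f≗g = cong₂ _+_ (∑<-cong m (λ j j<m → f≗g j (m<n⇒m<1+n j<m))) (f≗g m ≤-refl)

∑<-zero : (f : ℕ → ℕ) (m : ℕ) → (∀ j → j < m → f j ≡ 0) → ∑< m f ≡ 0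
∑<-zero f m f≡0 = trans (∑<-cong m f≡0) (zeros m)
  where
  zeros : ∀ m → ∑[ _ < m ] 0 ≡ 0
  zeros zero    = refl
  zeros (suc m) = cong (_+ 0) (zeros m)

∑<-unit : (f : ℕ → ℕ) (m j₀ : ℕ) → j₀ < m → f j₀ ≡ 1 → (∀ j → j < m → j ≢ j₀ → f j ≡ 0) → ∑< m f ≡ 1
∑<-unit f (suc m) j₀ j₀<1+m fj₀≡1 f≡0 with j₀ ≟ m
... | yes refl = cong₂ _+_ (∑<-zero f m (λ j j<m → f≡0 j (m<n⇒m<1+n j<m) (<⇒≢ j<m))) fj₀≡1
... | no j₀≢m  = cong₂ _+_
  (∑<-unit f m j₀ (≤∧≢⇒< (≤-pred j₀<1+m) j₀≢m) fj₀≡1 (λ j j<m → f≡0 j (m<n⇒m<1+n j<m)))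
  (f≡0 m ≤-refl (j₀≢m ∘ sym))

∑<-suc : (f : ℕ → ℕ) (m : ℕ) → ∑< (suc m) f ≡ f 0 + ∑< m (f ∘ suc)
∑<-suc f zero    = +-comm 0 (f 0)
∑<-suc f (suc m) = trans (cong (_+ f (suc m)) (∑<-suc f m)) (+-assoc (f 0) _ _)

∑<-+ : (f : ℕ → ℕ) (a b : ℕ) → ∑< (a + b) f ≡ ∑< a f + ∑[ j < b ] f (a + j)
∑<-+ f a zero    = trans (cong (λ m → ∑< m f) (+-identityʳ a)) (sym (+-identityʳ _))
∑<-+ f a (suc b) = trans (cong (λ m → ∑< m f) (+-suc a b))
  (trans (cong (_+ f (a + b)) (∑<-+ f a b)) (+-assoc (∑< a f) _ _))

∑<-add : (f g : ℕ → ℕ) (m : ℕ) → ∑[ j < m ] (f j + g j) ≡ ∑< m f + ∑< m g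
∑<-add f g zero    = refl
∑<-add f g (suc m) = trans (cong (_+ (f m + g m)) (∑<-add f g m)) (+-+-comm (∑< m f) (∑< m g) (f m) (g m))
  where
  +-+-comm : ∀ a b c d → a + b + (c + d) ≡ a + c + (b + d)
  +-+-comm = solve-∀

∑<-const : (c m : ℕ) → ∑[ _ < m ] c ≡ m * c
∑<-const c zero    = refl
∑<-const c (suc m) = trans (cong (_+ c) (∑<-const c m)) (+-comm (m * c) c)

∑<-reverse : (f : ℕ → ℕ) (m : ℕ) → ∑< m f ≡ ∑[ j < m ] f (m ∸ suc j)
∑<-reverse f zero    = refl
∑<-reverse f (suc m) = trans (cong (_+ f m) (∑<-reverse f m))
  (trans (+-comm _ (f m)) (sym (∑<-suc (λ j → f (suc m ∸ suc j)) m)))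

∑-applyUpTo : (F g : ℕ → ℕ) (m : ℕ) → ∑ F (applyUpTo g m) ≡ ∑[ j < m ] F (g j)
∑-applyUpTo F g zero    = refl
∑-applyUpTo F g (suc m) =
  trans (cong (F (g 0) +_) (∑-applyUpTo F (g ∘ suc) m)) (sym (∑<-suc (F ∘ g) m))

∑-∑< : {A : Set} (G : ℕ → A → ℕ) (m : ℕ) (L : List A) →
  ∑ (λ x → ∑[ i < m ] G i x) L ≡ ∑[ i < m ] ∑ (G i) L
∑-∑< G zero    L = ∑-zero L
∑-∑< G (suc m) L = trans (∑-+ (λ x → ∑[ i < m ] G i x) (G m) L) (cong (_+ ∑ (G m) L) (∑-∑< G m L))

-- Sums over the lists with bounded entries

∑-lists-suc : (B n : ℕ) (F : List ℕ → ℕ) →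
  ∑ F (lists B (suc n)) ≡ ∑[ x < suc B ] ∑ (F ∘ (x ∷_)) (lists B n)
∑-lists-suc B n F = begin
  ∑ F (concatMap (λ x → map (x ∷_) (lists B n)) (upTo (suc B)))
    ≡⟨ ∑-concatMap F (λ x → map (x ∷_) (lists B n)) (upTo (suc B)) ⟩
  ∑ (λ x → ∑ F (map (x ∷_) (lists B n))) (upTo (suc B))
    ≡⟨ ∑-cong (λ x → ∑-map F (x ∷_) (lists B n)) (upTo (suc B)) ⟩
  ∑ (λ x → ∑ (F ∘ (x ∷_)) (lists B n)) (upTo (suc B))
    ≡⟨ ∑-applyUpTo (λ x → ∑ (F ∘ (x ∷_)) (lists B n)) id (suc B) ⟩
  ∑[ x < suc B ] ∑ (F ∘ (x ∷_)) (lists B n) ∎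
  where open ≡-Reasoning

∑-lists-cong : (B n : ℕ) {F G : List ℕ → ℕ} →
  (∀ s → length s ≡ n → All (_≤ B) s → F s ≡ G s) → ∑ F (lists B n) ≡ ∑ G (lists B n)
∑-lists-cong B zero    F≗G = cong (_+ 0) (F≗G [] refl [])
∑-lists-cong B (suc n) {F} {G} F≗G = trans (∑-lists-suc B n F) (trans
  (∑<-cong (suc B) (λ x x≤B → ∑-lists-cong B n (λ s ∣s∣≡n s≤B → F≗G (x ∷ s) (cong suc ∣s∣≡n) (≤-pred x≤B ∷ s≤B))))
  (sym (∑-lists-suc B n G)))

∑-lists-++ : (B a b : ℕ) (F : List ℕ → ℕ) →
  ∑ F (lists B (a + b)) ≡ ∑ (λ u → ∑ (λ v → F (u ++ v)) (lists B b)) (lists B a)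
∑-lists-++ B zero    b F = sym (+-identityʳ _)
∑-lists-++ B (suc a) b F = trans (∑-lists-suc B (a + b) F) (trans
  (∑<-cong (suc B) (λ x _ → ∑-lists-++ B a b (F ∘ (x ∷_))))
  (sym (∑-lists-suc B a (λ u → ∑ (λ v → F (u ++ v)) (lists B b)))))

_≟ₗ_ : (u v : List ℕ) → Dec (u ≡ v)
_≟ₗ_ = ≡-dec _≟_

∑-lists-≡ : (B n : ℕ) (v : List ℕ) → length v ≡ n → All (_≤ B) v →
  ∑ (λ u → 𝟙 (u ≟ₗ v)) (lists B n) ≡ 1
∑-lists-≡ B zero    []      _      _            = refl
∑-lists-≡ B (suc n) (y ∷ v) ∣v∣≡n (y≤B ∷ v≤B) = trans (∑-lists-suc B n _) (trans
  (∑<-cong (suc B) (λ x _ → begin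
    ∑ (λ u → 𝟙 ((x ∷ u) ≟ₗ (y ∷ v))) (lists B n)   ≡⟨ ∑-cong (λ u → 𝟙-∷ x u) (lists B n) ⟩
    ∑ (λ u → 𝟙 (x ≟ y) * 𝟙 (u ≟ₗ v)) (lists B n)  ≡⟨ ∑-*ˡ (𝟙 (x ≟ y)) _ (lists B n) ⟩
    𝟙 (x ≟ y) * ∑ (λ u → 𝟙 (u ≟ₗ v)) (lists B n)  ≡⟨ cong (𝟙 (x ≟ y) *_) (∑-lists-≡ B n v (suc-injective ∣v∣≡n) v≤B) ⟩
    𝟙 (x ≟ y) * 1                                  ≡⟨ *-identityʳ _ ⟩
    𝟙 (x ≟ y)                                      ∎))
  (∑<-unit (λ x → 𝟙 (x ≟ y)) (suc B) y (s≤s y≤B) (𝟙-yes refl (y ≟ y)) (λ x _ x≢y → 𝟙-no x≢y (x ≟ y))))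
  where
  open ≡-Reasoning
  𝟙-∷ : ∀ x u → 𝟙 ((x ∷ u) ≟ₗ (y ∷ v)) ≡ 𝟙 (x ≟ y) * 𝟙 (u ≟ₗ v)
  𝟙-∷ x u = trans (𝟙-cong (mk⇔ ∷-injective (λ { (refl , refl) → refl })) _ (x ≟ y ×-dec u ≟ₗ v))
                  (𝟙-× (x ≟ y) (u ≟ₗ v))

∑<-translate : (i B : ℕ) → i ≤ B → (H : ℕ → ℕ) →
  ∑[ x < suc B ] (𝟙 (i ≤? x) * H (x ∸ i)) ≡ ∑< (suc (B ∸ i)) H
∑<-translate i B i≤B H = begin
  ∑< (suc B) G                               ≡⟨ cong (λ m → ∑< m G) 1+B≡i+[1+B∸i] ⟩
  ∑< (i + suc (B ∸ i)) G                     ≡⟨ ∑<-+ G i (suc (B ∸ i)) ⟩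
  ∑< i G + ∑[ j < suc (B ∸ i) ] G (i + j)    ≡⟨ cong₂ _+_ (∑<-zero G i below) (∑<-cong (suc (B ∸ i)) above) ⟩
  ∑< (suc (B ∸ i)) H                         ∎
  where
  open ≡-Reasoning
  G : ℕ → ℕ
  G x = 𝟙 (i ≤? x) * H (x ∸ i)
  1+B≡i+[1+B∸i] : suc B ≡ i + suc (B ∸ i)
  1+B≡i+[1+B∸i] = trans (cong suc (sym (m+[n∸m]≡n i≤B))) (sym (+-suc i (B ∸ i)))
  below : ∀ x → x < i → G x ≡ 0
  below x x<i = cong (_* H (x ∸ i)) (𝟙-no (<⇒≱ x<i) (i ≤? x))
  above : ∀ j → j < suc (B ∸ i) → G (i + j) ≡ H j
  above j _ = trans (cong₂ _*_ (𝟙-yes (m≤m+n i j) (i ≤? i + j)) (cong H (m+n∸m≡n i j))) (+-identityʳ _)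

∑-lists-translate : (B i k : ℕ) → i ≤ B → (F : List ℕ → ℕ) →
  ∑ (λ m → 𝟙 (all? (i ≤?_) m) * F (map (_∸ i) m)) (lists B k) ≡ ∑ F (lists (B ∸ i) k)
∑-lists-translate B i zero    i≤B F = cong (_+ 0) (+-identityʳ (F []))
∑-lists-translate B i (suc k) i≤B F = trans (∑-lists-suc B k _) (trans
  (∑<-cong (suc B) (λ x _ → begin
    ∑ (λ m → 𝟙 (all? (i ≤?_) (x ∷ m)) * F (map (_∸ i) (x ∷ m))) (lists B k)
      ≡⟨ ∑-cong (λ m → trans (cong (_* F (map (_∸ i) (x ∷ m))) (𝟙-all-∷ x m)) (*-assoc (𝟙 (i ≤? x)) (𝟙 (all? (i ≤?_) m)) _)) (lists B k) ⟩
    ∑ (λ m → 𝟙 (i ≤? x) * (𝟙 (all? (i ≤?_) m) * F ((x ∸ i) ∷ map (_∸ i) m))) (lists B k)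
      ≡⟨ ∑-*ˡ (𝟙 (i ≤? x)) _ (lists B k) ⟩
    𝟙 (i ≤? x) * ∑ (λ m → 𝟙 (all? (i ≤?_) m) * F ((x ∸ i) ∷ map (_∸ i) m)) (lists B k)
      ≡⟨ cong (𝟙 (i ≤? x) *_) (∑-lists-translate B i k i≤B (F ∘ ((x ∸ i) ∷_))) ⟩
    𝟙 (i ≤? x) * ∑ (F ∘ ((x ∸ i) ∷_)) (lists (B ∸ i) k) ∎))
  (trans (∑<-translate i B i≤B (λ y → ∑ (F ∘ (y ∷_)) (lists (B ∸ i) k))) (sym (∑-lists-suc (B ∸ i) k F))))
  where
  open ≡-Reasoning
  𝟙-all-∷ : ∀ x m → 𝟙 (all? (i ≤?_) (x ∷ m)) ≡ 𝟙 (i ≤? x) * 𝟙 (all? (i ≤?_) m)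
  𝟙-all-∷ x m = trans (𝟙-cong (mk⇔ (λ { (p ∷ ps) → p , ps }) (λ { (p , ps) → p ∷ ps })) _ (i ≤? x ×-dec all? (i ≤?_) m))
                      (𝟙-× (i ≤? x) (all? (i ≤?_) m))

∑-lists-shrink : (B B₀ n : ℕ) → B₀ ≤ B → (F : List ℕ → ℕ) → (∀ s → ¬ All (_≤ B₀) s → F s ≡ 0) →
  ∑ F (lists B n) ≡ ∑ F (lists B₀ n)
∑-lists-shrink B B₀ zero    B₀≤B F _      = refl
∑-lists-shrink B B₀ (suc n) B₀≤B F F≡0 = begin
  ∑ F (lists B (suc n))                        ≡⟨ ∑-lists-suc B n F ⟩
  ∑[ x < suc B ] ∑ (F ∘ (x ∷_)) (lists B n)   ≡⟨ ∑<-cong (suc B) (λ x _ → ∑-lists-shrink B B₀ n B₀≤B (F ∘ (x ∷_)) (tail≡0 x)) ⟩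
  ∑< (suc B) G                                 ≡⟨ cong (λ m → ∑< m G) (cong suc (sym (m+[n∸m]≡n B₀≤B))) ⟩
  ∑< (suc B₀ + (B ∸ B₀)) G                     ≡⟨ ∑<-+ G (suc B₀) (B ∸ B₀) ⟩
  ∑< (suc B₀) G + ∑[ j < B ∸ B₀ ] G (suc B₀ + j) ≡⟨ cong (∑< (suc B₀) G +_) (∑<-zero _ (B ∸ B₀) (λ j _ → head>B₀ j)) ⟩
  ∑< (suc B₀) G + 0                            ≡⟨ +-identityʳ _ ⟩
  ∑< (suc B₀) G                                ≡⟨ ∑-lists-suc B₀ n F ⟨
  ∑ F (lists B₀ (suc n))                       ∎
  where
  open ≡-Reasoning
  G : ℕ → ℕ
  G x = ∑ (F ∘ (x ∷_)) (lists B₀ n)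
  tail≡0 : ∀ x s → ¬ All (_≤ B₀) s → F (x ∷ s) ≡ 0
  tail≡0 x s ¬s≤B₀ = F≡0 (x ∷ s) (λ { (_ ∷ s≤B₀) → ¬s≤B₀ s≤B₀ })
  head>B₀ : ∀ j → G (suc B₀ + j) ≡ 0
  head>B₀ j = trans (∑-cong (λ s → F≡0 _ (λ { (x≤B₀ ∷ _) → <⇒≱ (s≤s (m≤m+n B₀ j)) x≤B₀ })) (lists B₀ n))
                    (∑-zero (lists B₀ n))

-- Arithmetic of C(r,2) and of halving

C₂ : ℕ → ℕ
C₂ zero    = 0
C₂ (suc r) = C₂ r + r

C2≡C₂ : ∀ r → r C 2 ≡ C₂ r
C2≡C₂ zero    = refl
C2≡C₂ (suc r) = trans (sym (nCk+nC[k+1]≡[n+1]C[k+1] r 1)) (trans (cong₂ _+_ (nC1≡n r) (C2≡C₂ r)) (+-comm r (C₂ r)))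

C₂-+ : ∀ a b → C₂ (a + b) ≡ C₂ a + C₂ b + a * b
C₂-+ a zero    = trans (cong C₂ (+-identityʳ a)) (sym (trans (cong (C₂ a + 0 +_) (*-zeroʳ a)) (trans (+-identityʳ _) (+-identityʳ _))))
C₂-+ a (suc b) = trans (cong C₂ (+-suc a b)) (trans (cong (_+ (a + b)) (C₂-+ a b)) (lemma (C₂ a) (C₂ b) a b))
  where
  lemma : ∀ x y a b → x + y + a * b + (a + b) ≡ x + (y + b) + a * suc b
  lemma = solve-∀

C₂-double : ∀ q → C₂ q + C₂ q + q ≡ q * q
C₂-double zero    = refl
C₂-double (suc q) = trans (lemma (C₂ q) q) (trans (cong (_+ (q + suc q)) (C₂-double q)) (square q))
  where
  lemma : ∀ x q → (x + q) + (x + q) + suc q ≡ (x + x + q) + (q + suc q)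
  lemma = solve-∀
  square : ∀ q → q * q + (q + suc q) ≡ suc q * suc q
  square = solve-∀

-- The form of C(a+b,2) + C(b,2) = C(a,2) + b(a+b-1) without subtraction.
C₂-+-C₂ : ∀ a b → C₂ (a + b) + C₂ b + b ≡ C₂ a + b * (a + b)
C₂-+-C₂ a b = begin
  C₂ (a + b) + C₂ b + b               ≡⟨ cong (λ x → x + C₂ b + b) (C₂-+ a b) ⟩
  C₂ a + C₂ b + a * b + C₂ b + b      ≡⟨ lemma (C₂ a) (C₂ b) a b ⟩
  C₂ a + (C₂ b + C₂ b + b) + a * b    ≡⟨ cong (λ x → C₂ a + x + a * b) (C₂-double b) ⟩
  C₂ a + b * b + a * b                ≡⟨ square (C₂ a) a b ⟩
  C₂ a + b * (a + b)                  ∎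
  where
  open ≡-Reasoning
  lemma : ∀ x y a b → x + y + a * b + y + b ≡ x + (y + y + b) + a * b
  lemma = solve-∀
  square : ∀ x a b → x + b * b + a * b ≡ x + b * (a + b)
  square = solve-∀

C₂-mono : ∀ {a b} → a ≤ b → C₂ a ≤ C₂ b
C₂-mono {a} {b} a≤b = subst (C₂ a ≤_) (sym (trans (cong C₂ (sym (m+[n∸m]≡n a≤b))) (C₂-+ a (b ∸ a))))
  (≤-trans (m≤m+n (C₂ a) (C₂ (b ∸ a))) (m≤m+n _ (a * (b ∸ a))))

pred≤C₂ : ∀ n → n ∸ 1 ≤ C₂ n
pred≤C₂ zero    = z≤n
pred≤C₂ (suc n) = m≤n+m n (C₂ n)

*-pred-+ : ∀ {b n} → b + b ≤ n → b * (n ∸ 1) + b ≡ b * n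
*-pred-+ {b} {zero}   b+b≤0 = trans (cong (λ x → x * 0 + x) (n≤0⇒n≡0 (≤-trans (m≤m+n b b) b+b≤0))) (sym (*-zeroʳ b))
*-pred-+ {b} {suc n'} _     = trans (+-comm (b * n') b) (sym (*-suc b n'))

<n/2⇒ : ∀ {j n} → j < n / 2 → suc j + suc j ≤ n
<n/2⇒ {j} {n} j<n/2 = subst (_≤ n) (double (suc j)) (≤-trans (*-monoˡ-≤ 2 j<n/2) (m/n*n≤m n 2))
  where
  double : ∀ x → x * 2 ≡ x + x
  double = solve-∀

⇒<n/2 : ∀ {j n} → suc j + suc j ≤ n → j < n / 2
⇒<n/2 {j} {n} 2[1+j]≤n = subst (_≤ n / 2) (m*n/n≡m (suc j) 2) (/-monoˡ-≤ 2 (subst (_≤ n) (double (suc j)) 2[1+j]≤n))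
  where
  double : ∀ x → x + x ≡ x * 2
  double = solve-∀

!-++ˡ : ∀ xs ys j → j < length xs → (xs ++ ys) ! j ≡ xs ! j
!-++ˡ (x ∷ xs) ys zero    _         = refl
!-++ˡ (x ∷ xs) ys (suc j) (s≤s j<) = !-++ˡ xs ys j j<

!-++ʳ : ∀ xs ys j → (xs ++ ys) ! (length xs + j) ≡ ys ! j
!-++ʳ []       ys j = refl
!-++ʳ (x ∷ xs) ys j = !-++ʳ xs ys j

!-map : ∀ (f : ℕ → ℕ) s j → j < length s → map f s ! j ≡ f (s ! j)
!-map f (x ∷ s) zero    _         = refl
!-map f (x ∷ s) (suc j) (s≤s j<) = !-map f s j j<

!-applyUpTo : ∀ (g : ℕ → ℕ) m j → j < m → applyUpTo g m ! j ≡ g j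
!-applyUpTo g (suc m) zero    _         = refl
!-applyUpTo g (suc m) (suc j) (s≤s j<) = !-applyUpTo (g ∘ suc) m j j<

!-take : ∀ i s j → j < i → take i s ! j ≡ s ! j
!-take (suc i) []      j       _         = refl
!-take (suc i) (x ∷ s) zero    _         = refl
!-take (suc i) (x ∷ s) (suc j) (s≤s j<) = !-take i s j j<

!-ext : ∀ (a b : List ℕ) → length a ≡ length b → (∀ j → j < length a → a ! j ≡ b ! j) → a ≡ b
!-ext []      []      _    _   = refl
!-ext (x ∷ a) (y ∷ b) ∣a∣≡ a≗b = cong₂ _∷_ (a≗b zero (s≤s z≤n)) (!-ext a b (suc-injective ∣a∣≡) (λ j j< → a≗b (suc j) (s≤s j<)))

All⇒! : ∀ {P : ℕ → Set} s → All P s → ∀ j → j < length s → P (s ! j)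
All⇒! (x ∷ s) (px ∷ ps) zero    _         = px
All⇒! (x ∷ s) (px ∷ ps) (suc j) (s≤s j<) = All⇒! s ps j j<

!⇒All : ∀ {P : ℕ → Set} s → (∀ j → j < length s → P (s ! j)) → All P s
!⇒All []      _  = []
!⇒All (x ∷ s) Ps = Ps zero (s≤s z≤n) ∷ !⇒All s (λ j j< → Ps (suc j) (s≤s j<))

take-length-++ : ∀ (xs ys : List ℕ) → take (length xs) (xs ++ ys) ≡ xs
take-length-++ []       ys = refl
take-length-++ (x ∷ xs) ys = cong (x ∷_) (take-length-++ xs ys)

All-head-++ : ∀ {P : ℕ → Set} xs ys → All P xs → (0 < length ys → P (ys ! 0)) →
  0 < length (xs ++ ys) → P ((xs ++ ys) ! 0)
All-head-++ []       ys _          Pys 0< = Pys 0<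
All-head-++ (x ∷ xs) ys (Px ∷ _) _   _  = Px

psum : List ℕ → ℕ → ℕ
psum s r = ∑[ j < r ] (s ! j)

psum-cong : ∀ s s' r → (∀ j → j < r → s ! j ≡ s' ! j) → psum s r ≡ psum s' r
psum-cong s s' r = ∑<-cong r

sum-take≡psum : ∀ r s → sum (take r s) ≡ psum s r
sum-take≡psum zero    s       = refl
sum-take≡psum (suc r) []      = sym (∑<-zero _ (suc r) (λ _ _ → refl))
sum-take≡psum (suc r) (x ∷ s) = trans (cong (x +_) (sum-take≡psum r s)) (sym (∑<-suc ((x ∷ s) !_) r))

psum-take : ∀ i s r → r ≤ i → psum (take i s) r ≡ psum s r
psum-take i s r r≤i = psum-cong (take i s) s r (λ j j<r → !-take i s j (<-≤-trans j<r r≤i))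

psum-++ˡ : ∀ xs ys r → r ≤ length xs → psum (xs ++ ys) r ≡ psum xs r
psum-++ˡ xs ys r r≤ = psum-cong (xs ++ ys) xs r (λ j j<r → !-++ˡ xs ys j (<-≤-trans j<r r≤))

psum-++ : ∀ xs ys r → psum (xs ++ ys) (length xs + r) ≡ psum xs (length xs) + psum ys r
psum-++ xs ys r = trans (∑<-+ ((xs ++ ys) !_) (length xs) r)
  (cong₂ _+_ (psum-++ˡ xs ys (length xs) ≤-refl) (∑<-cong r (λ j _ → !-++ʳ xs ys j)))

psum-map-∸ : ∀ m i r → r ≤ length m → All (i ≤_) m → psum (map (_∸ i) m) r + r * i ≡ psum m r
psum-map-∸ m i zero    _  _   = refl
psum-map-∸ m i (suc r) r< i≤m = begin
  psum m' r + m' ! r + (i + r * i)    ≡⟨ lemma (psum m' r) (m' ! r) i (r * i) ⟩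
  (psum m' r + r * i) + (m' ! r + i)  ≡⟨ cong₂ _+_ (psum-map-∸ m i r (<⇒≤ r<) i≤m) (cong (_+ i) (!-map (_∸ i) m r r<)) ⟩
  psum m r + (m ! r ∸ i + i)          ≡⟨ cong (psum m r +_) (m∸n+n≡m (All⇒! m i≤m r r<)) ⟩
  psum m r + m ! r                    ∎
  where
  open ≡-Reasoning
  m' = map (_∸ i) m
  lemma : ∀ a b c d → a + b + (c + d) ≡ (a + d) + (b + c)
  lemma = solve-∀

Nondecreasing : List ℕ → Set
Nondecreasing s = ∀ j → suc j < length s → s ! j ≤ s ! suc j

Linked⇔Nondecreasing : ∀ s → Linked _≤_ s ⇔ Nondecreasing s
Linked⇔Nondecreasing s = mk⇔ to (from s)
  where
  to : ∀ {s} → Linked _≤_ s → Nondecreasing s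
  to (x≤y ∷ _)   zero    _           = x≤y
  to (_ ∷ l)     (suc j) (s≤s 2+j<) = to l j 2+j<
  to [-]         j       (s≤s ())
  from : ∀ s → Nondecreasing s → Linked _≤_ s
  from []          _  = []
  from (x ∷ [])    _  = [-]
  from (x ∷ y ∷ s) nd = nd zero (s≤s (s≤s z≤n)) ∷ from (y ∷ s) (λ j j< → nd (suc j) (s≤s j<))

Nondecreasing-≤ : ∀ s → Nondecreasing s → ∀ {j j'} → j ≤ j' → j' < length s → s ! j ≤ s ! j'
Nondecreasing-≤ s nd {j} {zero}   z≤n  _  = ≤-refl
Nondecreasing-≤ s nd {j} {suc j'} j≤ j'< with m≤n⇒m<n∨m≡n j≤
... | inj₂ refl       = ≤-refl
... | inj₁ (s≤s j≤j') = ≤-trans (Nondecreasing-≤ s nd j≤j' (<-trans (n<1+n j') j'<)) (nd j' j'<)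

Nondecreasing-++ : ∀ xs ys → Nondecreasing xs → Nondecreasing ys →
  (∀ j → suc j ≡ length xs → 0 < length ys → xs ! j ≤ ys ! 0) → Nondecreasing (xs ++ ys)
Nondecreasing-++ []           ys _   ndy _    j       j<            = ndy j j<
Nondecreasing-++ (x ∷ [])     ys _   _   last zero    (s≤s 0<)      = last 0 refl 0<
Nondecreasing-++ (x ∷ [])     ys _   ndy _    (suc j) (s≤s j<)      = ndy j j<
Nondecreasing-++ (x ∷ y ∷ xs) ys ndx _   _    zero    _             = ndx 0 (s≤s (s≤s z≤n))
Nondecreasing-++ (x ∷ y ∷ xs) ys ndx ndy last (suc j) (s≤s j<) =
  Nondecreasing-++ (y ∷ xs) ys (λ j j< → ndx (suc j) (s≤s j<)) ndy (λ j e → last (suc j) (cong suc e)) j j<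

-- Score sequences in index form

record Score (n : ℕ) (s : List ℕ) : Set where
  constructor score
  field
    length≡       : length s ≡ n
    nondecreasing : Nondecreasing s
    landau        : ∀ r → suc r < n → C₂ (suc r) ≤ psum s (suc r)
    total         : psum s n ≡ C₂ n

open Score

Strong : ℕ → List ℕ → Set
Strong n s = ∀ r → suc r < n → C₂ (suc r) < psum s (suc r)

SelfComp : ℕ → List ℕ → Set
SelfComp n s = ∀ j → suc j + suc j ≤ n → s ! (n ∸ 1 ∸ j) ≡ (n ∸ 1) ∸ s ! j

All-range1⇔ : ∀ {P : ℕ → Set} n → All P (range1 n) ⇔ (∀ r → suc r < n → P (suc r))
All-range1⇔ n = mk⇔ (to n) (from n)
  where
  to : ∀ {P : ℕ → Set} n → All P (range1 n) → ∀ r → suc r < n → P (suc r)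
  to (suc n) Ps r (s≤s r<n) = applyUpTo⁻ id n (map⁻ Ps) r<n
  from : ∀ {P : ℕ → Set} n → (∀ r → suc r < n → P (suc r)) → All P (range1 n)
  from zero    _  = []
  from (suc n) Ps = map⁺ (applyUpTo⁺₁ id n (λ r<n → Ps _ (s≤s r<n)))

landau⇔ : ∀ (_R_ : ℕ → ℕ → Set) n s →
  All (λ r → (r C 2) R (sum (take r s))) (range1 n) ⇔ (∀ r → suc r < n → (C₂ (suc r)) R (psum s (suc r)))
landau⇔ _R_ n s = mk⇔
  (λ Ps r r< → subst₂ _R_ (C2≡C₂ (suc r)) (sum-take≡psum (suc r) s) (Equivalence.to (All-range1⇔ n) Ps r r<))
  (λ Ps → Equivalence.from (All-range1⇔ n) (λ r r< → subst₂ _R_ (sym (C2≡C₂ (suc r))) (sym (sum-take≡psum (suc r) s)) (Ps r r<)))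

sum≡psum : ∀ n s → length s ≡ n → sum s ≡ psum s n
sum≡psum _ s refl = trans (cong sum (sym (take-all (length s) s ≤-refl))) (sum-take≡psum (length s) s)

IsScoreSeq⇔Score : ∀ n s → IsScoreSeq n s ⇔ Score n s
IsScoreSeq⇔Score n s = mk⇔
  (λ (∣s∣≡n , linked , lan , tot) → score ∣s∣≡n (Equivalence.to (Linked⇔Nondecreasing s) linked)
    (Equivalence.to (landau⇔ _≤_ n s) lan) (trans (sym (sum≡psum n s ∣s∣≡n)) (trans tot (C2≡C₂ n))))
  (λ (score ∣s∣≡n nd lan tot) → ∣s∣≡n , Equivalence.from (Linked⇔Nondecreasing s) nd ,
    Equivalence.from (landau⇔ _≤_ n s) lan , trans (sum≡psum n s ∣s∣≡n) (trans tot (sym (C2≡C₂ n))))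

IsStrong⇔Strong : ∀ n s → IsStrong n s ⇔ Strong n s
IsStrong⇔Strong = landau⇔ _<_

IsSelfComp⇔SelfComp : ∀ n s → IsSelfComp n s ⇔ SelfComp n s
IsSelfComp⇔SelfComp n s = mk⇔
  (λ sc j 2[1+j]≤n → applyUpTo⁻ id (n / 2) sc (⇒<n/2 2[1+j]≤n))
  (λ sc → applyUpTo⁺₁ id (n / 2) (λ j<n/2 → sc _ (<n/2⇒ j<n/2)))

Score-last≤ : ∀ {n s} → Score (suc n) s → s ! n ≤ n
Score-last≤ {zero}      σ = ≤-reflexive (total σ)
Score-last≤ {suc r} {s} σ =
  +-cancelˡ-≤ (C₂ (suc r)) _ _ (≤-trans (+-monoˡ-≤ (s ! suc r) (landau σ r ≤-refl)) (≤-reflexive (total σ)))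

Score-entry≤ : ∀ {n s} → Score n s → ∀ j → j < n → s ! j ≤ n ∸ 1
Score-entry≤ {suc n} {s} σ j (s≤s j≤n) =
  ≤-trans (Nondecreasing-≤ s (nondecreasing σ) j≤n (subst (n <_) (sym (length≡ σ)) ≤-refl)) (Score-last≤ σ)

Score-landau≤ : ∀ {n s} → Score n s → ∀ r → r ≤ n → C₂ r ≤ psum s r
Score-landau≤ σ zero    _   = z≤n
Score-landau≤ σ (suc r) r<n with m≤n⇒m<n∨m≡n r<n
... | inj₁ 1+r<n = landau σ r 1+r<n
... | inj₂ refl  = ≤-reflexive (sym (total σ))

Score-All≤ : ∀ {n s} → Score n s → All (_≤ C₂ n) s
Score-All≤ {n} {s} σ = !⇒All s (λ j j< → ≤-trans (Score-entry≤ σ j (subst (j <_) (length≡ σ) j<)) (pred≤C₂ n))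

-- Self-complementary score sequences

least-counterexample : ∀ {P : ℕ → Set} → (∀ r → Dec (P r)) → ∀ m → ¬ (∀ r → r < m → P r) →
  ∃ λ r₀ → r₀ < m × ¬ P r₀ × (∀ r → r < r₀ → P r)
least-counterexample P? zero    ¬all = ⊥-elim (¬all (λ _ ()))
least-counterexample P? (suc m) ¬all with P? 0
... | no ¬P₀ = 0 , s≤s z≤n , ¬P₀ , (λ _ ())
... | yes P₀ with least-counterexample (P? ∘ suc) m (λ all → ¬all (λ { zero _ → P₀ ; (suc r) (s≤s r<m) → all r r<m }))
...   | r₀ , r₀<m , ¬P , below = suc r₀ , s≤s r₀<m , ¬P , λ { zero _ → P₀ ; (suc r) (s≤s r<r₀) → below r r<r₀ }

complement-split : ∀ {a n} → a < n → ¬ (a + a ≤ n) → ∃ λ q → a + suc q ≡ n × suc q < a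
complement-split {a} {n} a<n 2a≰n = n ∸ suc a , a+[1+q]≡n , +-cancelˡ-< a _ _ (subst (_< a + a) (sym a+[1+q]≡n) (≰⇒> 2a≰n))
  where
  a+[1+q]≡n : a + suc (n ∸ suc a) ≡ n
  a+[1+q]≡n = trans (+-suc a _) (m+[n∸m]≡n a<n)

module _ {n : ℕ} {s : List ℕ} (sc : SelfComp n s) (bounded : ∀ j → j < n → s ! j ≤ n ∸ 1) where

  psum-selfComp : ∀ q → q + q ≤ n → psum s (n ∸ q) + q * (n ∸ 1) ≡ psum s n + psum s q
  psum-selfComp q q+q≤n = sym (begin
    psum s n + psum s q                                 ≡⟨ cong (λ x → psum s x + psum s q) (sym a+q≡n) ⟩
    psum s (a + q) + psum s q                           ≡⟨ cong (_+ psum s q) (∑<-+ (s !_) a q) ⟩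
    psum s a + ∑[ j < q ] (s ! (a + j)) + psum s q      ≡⟨ +-assoc (psum s a) _ _ ⟩
    psum s a + (∑[ j < q ] (s ! (a + j)) + psum s q)    ≡⟨ cong (λ x → psum s a + (x + psum s q)) (∑<-reverse (λ j → s ! (a + j)) q) ⟩
    psum s a + (∑[ j < q ] (s ! (a + (q ∸ suc j))) + psum s q) ≡⟨ cong (psum s a +_) (sym (∑<-add _ _ q)) ⟩
    psum s a + ∑[ j < q ] (s ! (a + (q ∸ suc j)) + s ! j) ≡⟨ cong (psum s a +_) (∑<-cong q pair) ⟩
    psum s a + ∑[ _ < q ] (n ∸ 1)                      ≡⟨ cong (psum s a +_) (∑<-const (n ∸ 1) q) ⟩
    psum s a + q * (n ∸ 1)                              ∎)
    where
    open ≡-Reasoning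
    a = n ∸ q
    q≤n : q ≤ n
    q≤n = ≤-trans (m≤n+m q q) q+q≤n
    a+q≡n : a + q ≡ n
    a+q≡n = m∸n+n≡m q≤n
    pair : ∀ j → j < q → s ! (a + (q ∸ suc j)) + s ! j ≡ n ∸ 1
    pair j j<q = begin
      s ! (a + (q ∸ suc j)) + s ! j  ≡⟨ cong (λ x → s ! x + s ! j) mirror ⟩
      s ! (n ∸ 1 ∸ j) + s ! j        ≡⟨ cong (_+ s ! j) (sc j (≤-trans (+-mono-≤ j<q j<q) q+q≤n)) ⟩
      (n ∸ 1) ∸ s ! j + s ! j        ≡⟨ m∸n+n≡m (bounded j (<-≤-trans j<q q≤n)) ⟩
      n ∸ 1                          ∎
      where
      mirror : a + (q ∸ suc j) ≡ n ∸ 1 ∸ j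
      mirror = trans (sym (+-∸-assoc a j<q)) (trans (cong (_∸ suc j) a+q≡n) (sym (∸-+-assoc n 1 j)))

  module _ (psum≡C₂ : psum s n ≡ C₂ n) where

    tight-mirror : ∀ {a b} → a + b ≡ n → b ≤ a → psum s a + C₂ b ≡ C₂ a + psum s b
    tight-mirror {a} {b} a+b≡n b≤a = +-cancelʳ-≡ (b * n) _ _ (begin
      psum s a + C₂ b + b * n                    ≡⟨ cong (λ x → psum s a + C₂ b + x) (sym (*-pred-+ {b} b+b≤n)) ⟩
      psum s a + C₂ b + (b * (n ∸ 1) + b)        ≡⟨ lemma₁ (psum s a) (C₂ b) (b * (n ∸ 1)) b ⟩
      (psum s a + b * (n ∸ 1)) + (C₂ b + b)      ≡⟨ cong (λ x → psum s x + b * (n ∸ 1) + (C₂ b + b)) (sym n∸b≡a) ⟩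
      (psum s (n ∸ b) + b * (n ∸ 1)) + (C₂ b + b) ≡⟨ cong (_+ (C₂ b + b)) (psum-selfComp b b+b≤n) ⟩
      (psum s n + psum s b) + (C₂ b + b)         ≡⟨ cong (λ x → (x + psum s b) + (C₂ b + b)) (trans psum≡C₂ (cong C₂ (sym a+b≡n))) ⟩
      (C₂ (a + b) + psum s b) + (C₂ b + b)       ≡⟨ lemma₂ (C₂ (a + b)) (psum s b) (C₂ b) b ⟩
      (C₂ (a + b) + C₂ b + b) + psum s b         ≡⟨ cong (_+ psum s b) (C₂-+-C₂ a b) ⟩
      C₂ a + b * (a + b) + psum s b              ≡⟨ cong (λ x → C₂ a + b * x + psum s b) a+b≡n ⟩
      C₂ a + b * n + psum s b                    ≡⟨ lemma₃ (C₂ a) (b * n) (psum s b) ⟩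
      C₂ a + psum s b + b * n                    ∎)
      where
      open ≡-Reasoning
      b+b≤n : b + b ≤ n
      b+b≤n = subst (b + b ≤_) a+b≡n (+-monoˡ-≤ b b≤a)
      n∸b≡a : n ∸ b ≡ a
      n∸b≡a = trans (cong (_∸ b) (sym a+b≡n)) (m+n∸n≡m a b)
      lemma₁ : ∀ x y z w → x + y + (z + w) ≡ (x + z) + (y + w)
      lemma₁ = solve-∀
      lemma₂ : ∀ x y z w → (x + y) + (z + w) ≡ (x + z + w) + y
      lemma₂ = solve-∀
      lemma₃ : ∀ x y z → x + y + z ≡ x + z + y
      lemma₃ = solve-∀

    landau-from-half : (∀ r → suc r + suc r ≤ n → C₂ (suc r) ≤ psum s (suc r)) →
      ∀ r → suc r < n → C₂ (suc r) ≤ psum s (suc r)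
    landau-from-half half r 1+r<n with suc r + suc r ≤? n
    ... | yes 2[1+r]≤n = half r 2[1+r]≤n
    ... | no  2[1+r]≰n with complement-split 1+r<n 2[1+r]≰n
    ...   | q , 1+r+[1+q]≡n , 1+q<1+r = +-cancelʳ-≤ (C₂ (suc q)) _ _ (begin
      C₂ (suc r) + C₂ (suc q)     ≤⟨ +-monoʳ-≤ (C₂ (suc r)) (half q 2[1+q]≤n) ⟩
      C₂ (suc r) + psum s (suc q) ≡⟨ tight-mirror 1+r+[1+q]≡n (<⇒≤ 1+q<1+r) ⟨
      psum s (suc r) + C₂ (suc q) ∎)
      where
      open ≤-Reasoning
      2[1+q]≤n : suc q + suc q ≤ n
      2[1+q]≤n = subst (suc q + suc q ≤_) 1+r+[1+q]≡n (+-monoˡ-≤ (suc q) (<⇒≤ 1+q<1+r))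

strongScore? : ∀ n s → Dec (IsScoreSeq n s × IsStrong n s)
strongScore? n s = isScoreSeq? n s ×-dec isStrong? n s

selfCompScore? : ∀ n s → Dec (IsScoreSeq n s × IsSelfComp n s)
selfCompScore? n s = isScoreSeq? n s ×-dec isSelfComp? n s

length-take≤ : ∀ i (s : List ℕ) → i ≤ length s → length (take i s) ≡ i
length-take≤ zero    s       _         = refl
length-take≤ (suc i) (x ∷ s) (s≤s i≤) = cong suc (length-take≤ i s i≤)

Strong-take⇔ : ∀ i s → Strong i (take i s) ⇔ Strong i s
Strong-take⇔ i s = mk⇔
  (λ st r 1+r<i → subst (C₂ (suc r) <_) (psum-take i s (suc r) (<⇒≤ 1+r<i)) (st r 1+r<i))
  (λ st r 1+r<i → subst (C₂ (suc r) <_) (sym (psum-take i s (suc r) (<⇒≤ 1+r<i))) (st r 1+r<i))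

take-strongScore⇔ : ∀ {n s} → Score n s → ∀ i → i ≤ n →
  (IsScoreSeq i (take i s) × IsStrong i (take i s)) ⇔ (psum s i ≡ C₂ i × Strong i s)
take-strongScore⇔ {n} {s} σ i i≤n = mk⇔
  (λ (isScore , isStrong) →
    trans (sym (psum-take i s i ≤-refl)) (total (Equivalence.to (IsScoreSeq⇔Score i _) isScore)) ,
    Equivalence.to (Strong-take⇔ i s) (Equivalence.to (IsStrong⇔Strong i _) isStrong))
  (λ (tight , st) → let st' = Equivalence.from (Strong-take⇔ i s) st in
    Equivalence.from (IsScoreSeq⇔Score i _)
      (score (length-take≤ i s i≤∣s∣) nondecreasing-take (λ r 1+r<i → <⇒≤ (st' r 1+r<i))
             (trans (psum-take i s i ≤-refl) tight)) ,
    Equivalence.from (IsStrong⇔Strong i _) st')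
  where
  i≤∣s∣ : i ≤ length s
  i≤∣s∣ = subst (i ≤_) (sym (length≡ σ)) i≤n
  nondecreasing-take : Nondecreasing (take i s)
  nondecreasing-take j 1+j<∣t∣ = subst₂ _≤_ (sym (!-take i s j (<-trans (n<1+n j) 1+j<i))) (sym (!-take i s (suc j) 1+j<i))
    (nondecreasing σ j (<-≤-trans 1+j<i i≤∣s∣))
    where
    1+j<i : suc j < i
    1+j<i = subst (suc j <_) (length-take≤ i s i≤∣s∣) 1+j<∣t∣

<n/2⇒1+<n : ∀ {i n} → i < n / 2 → suc i < n
<n/2⇒1+<n {i} i<n/2 = <-≤-trans (m<m+n (suc i) (s≤s z≤n)) (<n/2⇒ i<n/2)

module _ {n : ℕ} {s : List ℕ} (σ : Score n s) (sc : SelfComp n s) where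

  first-tight-≤half : ∀ r₀ → suc r₀ < n → psum s (suc r₀) ≡ C₂ (suc r₀) →
    (∀ r → r < r₀ → C₂ (suc r) < psum s (suc r)) → suc r₀ + suc r₀ ≤ n
  first-tight-≤half r₀ 1+r₀<n tight strict with suc r₀ + suc r₀ ≤? n
  ... | yes 2[1+r₀]≤n = 2[1+r₀]≤n
  ... | no  2[1+r₀]≰n with complement-split 1+r₀<n 2[1+r₀]≰n
  ...   | q , 1+r₀+[1+q]≡n , 1+q<1+r₀ = ⊥-elim (<⇒≢ (strict q (≤-pred 1+q<1+r₀)) (sym tight-q))
    where
    tight-q : psum s (suc q) ≡ C₂ (suc q)
    tight-q = sym (+-cancelˡ-≡ (C₂ (suc r₀)) _ _ (trans (cong (_+ C₂ (suc q)) (sym tight))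
      (tight-mirror {n} {s} sc (Score-entry≤ σ) (total σ) 1+r₀+[1+q]≡n (<⇒≤ 1+q<1+r₀))))

  strong⊎strongPrefix : 𝟙 (isStrong? n s) + ∑[ i < n / 2 ] 𝟙 (strongScore? (suc i) (take (suc i) s)) ≡ 1
  strong⊎strongPrefix with isStrong? n s
  ... | yes isStrong = cong suc (∑<-zero _ (n / 2) (λ i i<n/2 → 𝟙-no (noPrefix i i<n/2) _))
    where
    noPrefix : ∀ i → i < n / 2 → ¬ (IsScoreSeq (suc i) (take (suc i) s) × IsStrong (suc i) (take (suc i) s))
    noPrefix i i<n/2 prefix = <⇒≢ (Equivalence.to (IsStrong⇔Strong n s) isStrong i (<n/2⇒1+<n i<n/2))
      (sym (proj₁ (Equivalence.to (take-strongScore⇔ σ (suc i) (<⇒≤ (<n/2⇒1+<n i<n/2))) prefix)))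
  ... | no ¬isStrong with least-counterexample (λ r → C₂ (suc r) <? psum s (suc r)) (n ∸ 1)
                            (λ strict → ¬isStrong (Equivalence.from (IsStrong⇔Strong n s)
                              (λ r 1+r<n → strict r (suc[m]≤n⇒m≤pred[n] 1+r<n))))
  ...   | r₀ , r₀<n-1 , ¬strict , strict =
    ∑<-unit _ (n / 2) r₀ r₀<n/2 (𝟙-yes prefix-r₀ _) (λ x x<n/2 x≢r₀ → 𝟙-no (noPrefix x x<n/2 x≢r₀) _)
    where
    1+r₀<n : suc r₀ < n
    1+r₀<n = pred-cancel-< r₀<n-1
    tight : psum s (suc r₀) ≡ C₂ (suc r₀)
    tight = ≤-antisym (≮⇒≥ ¬strict) (landau σ r₀ 1+r₀<n)
    r₀<n/2 : r₀ < n / 2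
    r₀<n/2 = ⇒<n/2 (first-tight-≤half r₀ 1+r₀<n tight strict)
    prefix-r₀ : IsScoreSeq (suc r₀) (take (suc r₀) s) × IsStrong (suc r₀) (take (suc r₀) s)
    prefix-r₀ = Equivalence.from (take-strongScore⇔ σ (suc r₀) (<⇒≤ 1+r₀<n)) (tight , λ r 1+r<1+r₀ → strict r (≤-pred 1+r<1+r₀))
    noPrefix : ∀ x → x < n / 2 → x ≢ r₀ → ¬ (IsScoreSeq (suc x) (take (suc x) s) × IsStrong (suc x) (take (suc x) s))
    noPrefix x x<n/2 x≢r₀ prefix with Equivalence.to (take-strongScore⇔ σ (suc x) (<⇒≤ (<n/2⇒1+<n x<n/2))) prefix | <-cmp x r₀
    ... | tight-x , _        | tri< x<r₀ _ _ = <⇒≢ (strict x x<r₀) (sym tight-x)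
    ... | _                  | tri≈ _ x≡r₀ _ = x≢r₀ x≡r₀
    ... | _       , strong-x | tri> _ _ x>r₀ = <⇒≢ (strong-x r₀ (s≤s x>r₀)) (sym tight)

-- Gluing s = t ++ m ++ w

C₂-shift : ∀ i r → C₂ (i + r) ≡ (C₂ i + r * i) + C₂ r
C₂-shift i r = trans (C₂-+ i r) (lemma (C₂ i) (C₂ r) i r)
  where
  lemma : ∀ x y i r → x + y + i * r ≡ (x + r * i) + y
  lemma = solve-∀

C₂-sandwich : ∀ i k → 0 < i → C₂ (i + (k + i)) ≡ C₂ k + k * i + i * (i + (k + i) ∸ 1)
C₂-sandwich (suc a) k _ = +-cancelʳ-≡ (suc a) _ _ (begin
  C₂ (i + (k + i)) + i                                 ≡⟨ cong (_+ i) (C₂-+ i (k + i)) ⟩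
  C₂ i + C₂ (k + i) + i * (k + i) + i                  ≡⟨ cong (λ x → C₂ i + x + i * (k + i) + i) (C₂-+ k i) ⟩
  C₂ i + (C₂ k + C₂ i + k * i) + i * (k + i) + i       ≡⟨ lemma₁ (C₂ i) (C₂ k) k i ⟩
  C₂ k + (C₂ i + C₂ i + i) + k * i + i * (k + i)       ≡⟨ cong (λ x → C₂ k + x + k * i + i * (k + i)) (C₂-double i) ⟩
  C₂ k + i * i + k * i + i * (k + i)                   ≡⟨ lemma₂ (C₂ k) k a ⟩
  C₂ k + k * i + i * (a + (k + i)) + i                 ∎)
  where
  open ≡-Reasoning
  i = suc a
  lemma₁ : ∀ x y k i → x + (y + x + k * i) + i * (k + i) + i ≡ y + (x + x + i) + k * i + i * (k + i)
  lemma₁ = solve-∀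
  lemma₂ : ∀ y k a → y + suc a * suc a + k * suc a + suc a * (k + suc a) ≡ y + k * suc a + suc a * (a + (k + suc a)) + suc a
  lemma₂ = solve-∀

C₂-+-≤-C₂-sandwich : ∀ i k → 0 < i → C₂ k + i ≤ C₂ (i + (k + i))
C₂-+-≤-C₂-sandwich i k 0<i = subst (C₂ k + i ≤_) (sym (C₂-sandwich i k 0<i))
  (+-mono-≤ (m≤m+n (C₂ k) (k * i)) (subst (_≤ i * (n ∸ 1)) (*-identityʳ i) (*-monoʳ-≤ i (m<n⇒0<n∸m 1<n))))
  where
  n : ℕ
  n = i + (k + i)
  1<n : 1 < n
  1<n = ≤-trans (+-mono-≤ 0<i 0<i) (+-monoʳ-≤ i (m≤n+m i k))

[m+o]∸[n+o]≡m∸n : ∀ m n o → (m + o) ∸ (n + o) ≡ m ∸ n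
[m+o]∸[n+o]≡m∸n m n o = trans (cong₂ _∸_ (+-comm m o) (+-comm n o)) ([m+n]∸[m+o]≡n∸o o m n)

∸-mirror : ∀ {i j} → j < i → i ∸ suc (i ∸ suc j) ≡ j
∸-mirror {i} {j} j<i = trans (cong (i ∸_) (sym (+-∸-assoc 1 j<i))) (m∸[m∸n]≡n (<⇒≤ j<i))

∸-mirror< : ∀ {i} j → 0 < i → i ∸ suc j < i
∸-mirror< {suc i} j _ = s≤s (m∸n≤m i j)

tail-index : ∀ i k {j} → j < i → i + (k + i) ∸ 1 ∸ j ≡ i + (k + (i ∸ suc j))
tail-index i k {j} j<i = begin
  i + (k + i) ∸ 1 ∸ j   ≡⟨ ∸-+-assoc (i + (k + i)) 1 j ⟩
  i + (k + i) ∸ suc j   ≡⟨ cong (_∸ suc j) (+-assoc i k i) ⟨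
  i + k + i ∸ suc j     ≡⟨ +-∸-assoc (i + k) j<i ⟩
  i + k + (i ∸ suc j)   ≡⟨ +-assoc i k _ ⟩
  i + (k + (i ∸ suc j)) ∎
  where open ≡-Reasoning

middle-index : ∀ i k {j} → j < k → i + (k + i) ∸ 1 ∸ (i + j) ≡ i + (k ∸ 1 ∸ j)
middle-index i k {j} j<k = begin
  i + (k + i) ∸ 1 ∸ (i + j)   ≡⟨ ∸-+-assoc (i + (k + i)) 1 (i + j) ⟩
  i + (k + i) ∸ suc (i + j)   ≡⟨ cong (i + (k + i) ∸_) (sym (+-suc i j)) ⟩
  i + (k + i) ∸ (i + suc j)   ≡⟨ [m+n]∸[m+o]≡n∸o i (k + i) (suc j) ⟩
  k + i ∸ suc j               ≡⟨ +-∸-comm i j<k ⟩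
  k ∸ suc j + i               ≡⟨ +-comm (k ∸ suc j) i ⟩
  i + (k ∸ suc j)             ≡⟨ cong (i +_) (∸-+-assoc k 1 j) ⟨
  i + (k ∸ 1 ∸ j)             ∎
  where open ≡-Reasoning

middle-mirror< : ∀ {k j} → j < k → k ∸ 1 ∸ j < k
middle-mirror< {suc k} {j} _ = s≤s (m∸n≤m k j)

pred[i+[k+i]] : ∀ i {k} → 0 < k → i + (k + i) ∸ 1 ≡ k ∸ 1 + i + i
pred[i+[k+i]] i {suc k} _ = trans (cong (_∸ 1) (+-suc i (k + i))) (+-comm i (k + i))

middle-half : ∀ i k j → suc (i + j) + suc (i + j) ≤ i + (k + i) ⇔ suc j + suc j ≤ k
middle-half i k j = mk⇔
  (λ h → +-cancelʳ-≤ (i + i) _ _ (subst₂ _≤_ (lemma₁ i j) (lemma₂ i k) h))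
  (λ h → subst₂ _≤_ (sym (lemma₁ i j)) (sym (lemma₂ i k)) (+-monoˡ-≤ (i + i) h))
  where
  lemma₁ : ∀ i j → suc (i + j) + suc (i + j) ≡ (suc j + suc j) + (i + i)
  lemma₁ = solve-∀
  lemma₂ : ∀ i k → i + (k + i) ≡ k + (i + i)
  lemma₂ = solve-∀

half⇒<i+k : ∀ i k r → suc r + suc r ≤ i + (k + i) → suc r ≤ i + k
half⇒<i+k i k r h = ≮⇒≥ (λ i+k<1+r → <-irrefl refl (<-≤-trans (+-mono-< i+k<1+r i+k<1+r) (≤-trans h bound)))
  where
  bound : i + (k + i) ≤ i + k + (i + k)
  bound = ≤-trans (m≤m+n (i + (k + i)) k) (≤-reflexive (lemma i k))
    where
    lemma : ∀ i k → i + (k + i) + k ≡ i + k + (i + k)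
    lemma = solve-∀

shift-complement : ∀ a i x → x ≤ a → (a + i + i) ∸ (x + i) ≡ (a ∸ x) + i
shift-complement a i x x≤a = trans ([m+o]∸[n+o]≡m∸n (a + i) x i) (+-∸-comm i x≤a)

unshift-complement : ∀ a i y → i ≤ y → (a + i + i) ∸ y ∸ i ≡ a ∸ (y ∸ i)
unshift-complement a i y i≤y = begin
  (a + i + i) ∸ y ∸ i             ≡⟨ ∸-+-assoc (a + i + i) y i ⟩
  (a + i + i) ∸ (y + i)           ≡⟨ cong (λ z → (a + i + i) ∸ (z + i)) (m∸n+n≡m i≤y) ⟨
  (a + i + i) ∸ (y ∸ i + i + i)   ≡⟨ [m+o]∸[n+o]≡m∸n (a + i) (y ∸ i + i) i ⟩
  (a + i) ∸ (y ∸ i + i)           ≡⟨ [m+o]∸[n+o]≡m∸n a (y ∸ i) i ⟩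
  a ∸ (y ∸ i)                     ∎
  where open ≡-Reasoning

k+i≤pred∸ : ∀ i k {x} → 0 < i → x ≤ i ∸ 1 → k + i ≤ i + (k + i) ∸ 1 ∸ x
k+i≤pred∸ (suc a) k {x} _ x≤a = subst (_≤ a + (k + suc a) ∸ x) (m+n∸m≡n a (k + suc a)) (∸-monoʳ-≤ (a + (k + suc a)) x≤a)

-- The last |t| entries of a self-complementary sequence of length n beginning with t.
dual : ℕ → List ℕ → List ℕ
dual n t = applyUpTo (λ j → (n ∸ 1) ∸ t ! (length t ∸ suc j)) (length t)

!-dual : ∀ n t {j} → j < length t → dual n t ! j ≡ (n ∸ 1) ∸ t ! (length t ∸ suc j)
!-dual n t {j} = !-applyUpTo _ (length t) j

length-dual : ∀ n t → length (dual n t) ≡ length t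
length-dual n t = length-applyUpTo _ (length t)

dual-All≤ : ∀ n t {B} → n ∸ 1 ≤ B → All (_≤ B) (dual n t)
dual-All≤ n t n-1≤B = !⇒All (dual n t) (λ j j< → subst (_≤ _) (sym (!-dual n t (subst (j <_) (length-dual n t) j<)))
  (≤-trans (m∸n≤m (n ∸ 1) (t ! (length t ∸ suc j))) n-1≤B))

psum-dual : ∀ n t → (∀ j → j < length t → t ! j ≤ n ∸ 1) →
  psum (dual n t) (length t) + psum t (length t) ≡ length t * (n ∸ 1)
psum-dual n t bounded = begin
  psum (dual n t) i + psum t i                        ≡⟨ cong (_+ psum t i) (∑<-cong i (λ j → !-dual n t)) ⟩
  ∑[ j < i ] ((n ∸ 1) ∸ t ! (i ∸ suc j)) + psum t i   ≡⟨ cong (_+ psum t i) (∑<-reverse (λ j → (n ∸ 1) ∸ t ! j) i) ⟨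
  ∑[ j < i ] ((n ∸ 1) ∸ t ! j) + psum t i             ≡⟨ ∑<-add _ _ i ⟨
  ∑[ j < i ] ((n ∸ 1) ∸ t ! j + t ! j)                ≡⟨ ∑<-cong i (λ j j<i → m∸n+n≡m (bounded j j<i)) ⟩
  ∑[ _ < i ] (n ∸ 1)                                  ≡⟨ ∑<-const (n ∸ 1) i ⟩
  i * (n ∸ 1)                                         ∎
  where
  open ≡-Reasoning
  i = length t

module Glue (t m w : List ℕ) (∣w∣≡∣t∣ : length w ≡ length t) (0<i : 0 < length t) where

  i k n : ℕ
  i = length t
  k = length m
  n = i + (k + i)

  s m' : List ℕ
  s  = t ++ (m ++ w)
  m' = map (_∸ i) m

  length-s : length s ≡ n
  length-s = trans (length-++ t) (cong (i +_) (trans (length-++ m) (cong (k +_) ∣w∣≡∣t∣)))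

  s!-t : ∀ j → j < i → s ! j ≡ t ! j
  s!-t j j<i = !-++ˡ t (m ++ w) j j<i

  s!-m : ∀ j → j < k → s ! (i + j) ≡ m ! j
  s!-m j j<k = trans (!-++ʳ t (m ++ w) j) (!-++ˡ m w j j<k)

  s!-w : ∀ j → s ! (i + (k + j)) ≡ w ! j
  s!-w j = trans (!-++ʳ t (m ++ w) (k + j)) (!-++ʳ m w j)

  psum-s-t : ∀ r → r ≤ i → psum s r ≡ psum t r
  psum-s-t r r≤i = psum-++ˡ t (m ++ w) r r≤i

  psum-s : psum s n ≡ psum t i + (psum m k + psum w i)
  psum-s = trans (psum-++ t (m ++ w) (k + i)) (cong (psum t i +_) (psum-++ m w i))

  m'!-m : ∀ j → j < k → m' ! j ≡ m ! j ∸ i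
  m'!-m j = !-map (_∸ i) m j

  module _ (i≤m : All (i ≤_) m) where

    m!-m' : ∀ j → j < k → m ! j ≡ m' ! j + i
    m!-m' j j<k = sym (trans (cong (_+ i) (m'!-m j j<k)) (m∸n+n≡m (All⇒! m i≤m j j<k)))

    module _ (tight-t : psum t i ≡ C₂ i) where

      psum-s-m : ∀ r → r ≤ k → psum s (i + r) ≡ (C₂ i + r * i) + psum m' r
      psum-s-m r r≤k = begin
        psum s (i + r)                  ≡⟨ psum-++ t (m ++ w) r ⟩
        psum t i + psum (m ++ w) r      ≡⟨ cong₂ _+_ tight-t (psum-++ˡ m w r r≤k) ⟩
        C₂ i + psum m r                 ≡⟨ cong (C₂ i +_) (psum-map-∸ m i r r≤k i≤m) ⟨
        C₂ i + (psum m' r + r * i)      ≡⟨ lemma (C₂ i) (psum m' r) (r * i) ⟩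
        (C₂ i + r * i) + psum m' r      ∎
        where
        open ≡-Reasoning
        lemma : ∀ x y z → x + (y + z) ≡ (x + z) + y
        lemma = solve-∀

      landau-m⇔ : ∀ r → r ≤ k → C₂ (i + r) ≤ psum s (i + r) ⇔ C₂ r ≤ psum m' r
      landau-m⇔ r r≤k = mk⇔
        (λ h → +-cancelˡ-≤ (C₂ i + r * i) _ _ (subst₂ _≤_ (C₂-shift i r) (psum-s-m r r≤k) h))
        (λ h → subst₂ _≤_ (sym (C₂-shift i r)) (sym (psum-s-m r r≤k)) (+-monoʳ-≤ (C₂ i + r * i) h))

      module _ (t≤ : ∀ j → j < i → t ! j ≤ n ∸ 1) (w≡dual : w ≡ dual n t) where

        total⇔ : psum s n ≡ C₂ n ⇔ psum m' k ≡ C₂ k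
        total⇔ = mk⇔
          (λ h → +-cancelʳ-≡ X _ _ (trans (sym psum-s≡) (trans h C₂-n≡)))
          (λ h → trans psum-s≡ (trans (cong (_+ X) h) (sym C₂-n≡)))
          where
          X : ℕ
          X = k * i + i * (n ∸ 1)
          w-sum : psum w i + C₂ i ≡ i * (n ∸ 1)
          w-sum = trans (cong₂ (λ u v → psum u i + v) w≡dual (sym tight-t)) (psum-dual n t t≤)
          psum-s≡ : psum s n ≡ psum m' k + X
          psum-s≡ = begin
            psum s n                                  ≡⟨ psum-s ⟩
            psum t i + (psum m k + psum w i)          ≡⟨ cong₂ (λ a b → a + (b + psum w i)) tight-t (sym (psum-map-∸ m i k ≤-refl i≤m)) ⟩
            C₂ i + ((psum m' k + k * i) + psum w i)   ≡⟨ lemma (C₂ i) (psum m' k) (k * i) (psum w i) ⟩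
            psum m' k + (k * i + (psum w i + C₂ i))   ≡⟨ cong (λ x → psum m' k + (k * i + x)) w-sum ⟩
            psum m' k + X                             ∎
            where
            open ≡-Reasoning
            lemma : ∀ c p q v → c + ((p + q) + v) ≡ p + (q + (v + c))
            lemma = solve-∀
          C₂-n≡ : C₂ n ≡ C₂ k + X
          C₂-n≡ = trans (C₂-sandwich i k 0<i) (+-assoc (C₂ k) (k * i) _)

  t-bounded : Score i t → ∀ j → j < i → t ! j ≤ n ∸ 1
  t-bounded τ j j<i = ≤-trans (Score-entry≤ τ j j<i) (∸-monoˡ-≤ 1 (m≤m+n i (k + i)))

  i+j<∣s∣ : ∀ j → j < k → i + j < length s
  i+j<∣s∣ j j<k = subst (i + j <_) (sym length-s) (+-monoʳ-< i (<-≤-trans j<k (m≤m+n k i)))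

  module Forward (σ : Score n s) (sc : SelfComp n s) (τ : Score i t) where

    i≤s!i : 0 < k → i ≤ s ! i
    i≤s!i 0<k = +-cancelˡ-≤ (C₂ i) _ _ (subst (C₂ i + i ≤_) (cong (_+ s ! i) (trans (psum-s-t i ≤-refl) (total τ)))
      (landau σ i (≤-<-trans (subst (_≤ i + k) (+-comm i 1) (+-monoʳ-≤ i 0<k)) (+-monoʳ-< i (m<m+n k 0<i)))))

    i≤m : All (i ≤_) m
    i≤m = !⇒All m (λ j j<k → ≤-trans (i≤s!i (≤-<-trans z≤n j<k))
      (subst (s ! i ≤_) (s!-m j j<k) (Nondecreasing-≤ s (nondecreasing σ) (m≤m+n i j) (i+j<∣s∣ j j<k))))

    w≡dual : w ≡ dual n t
    w≡dual = !-ext w (dual n t) (trans ∣w∣≡∣t∣ (sym (length-dual n t))) w!≡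
      where
      w!≡ : ∀ j → j < length w → w ! j ≡ dual n t ! j
      w!≡ j j<∣w∣ = begin
        w ! j                             ≡⟨ s!-w j ⟨
        s ! (i + (k + j))                 ≡⟨ cong (λ x → s ! (i + (k + x))) (∸-mirror j<i) ⟨
        s ! (i + (k + (i ∸ suc j')))      ≡⟨ cong (s !_) (tail-index i k j'<i) ⟨
        s ! (n ∸ 1 ∸ j')                  ≡⟨ sc j' (≤-trans (+-mono-≤ j'<i j'<i) (+-monoʳ-≤ i (m≤n+m i k))) ⟩
        (n ∸ 1) ∸ s ! j'                  ≡⟨ cong ((n ∸ 1) ∸_) (s!-t j' j'<i) ⟩
        (n ∸ 1) ∸ t ! j'                  ≡⟨ !-dual n t j<i ⟨
        dual n t ! j                      ∎
        where
        open ≡-Reasoning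
        j<i : j < i
        j<i = subst (j <_) ∣w∣≡∣t∣ j<∣w∣
        j' = i ∸ suc j
        j'<i : j' < i
        j'<i = ∸-mirror< j 0<i

    m'-nondecreasing : Nondecreasing m'
    m'-nondecreasing j 1+j<∣m'∣ = subst₂ _≤_ (sym (m'!≡ j j<k)) (sym (m'!≡ (suc j) 1+j<k))
      (∸-monoˡ-≤ i (subst (λ x → s ! (i + j) ≤ s ! x) (sym (+-suc i j))
        (nondecreasing σ (i + j) (subst (_< length s) (+-suc i j) (i+j<∣s∣ (suc j) 1+j<k)))))
      where
      1+j<k : suc j < k
      1+j<k = subst (suc j <_) (length-map (_∸ i) m) 1+j<∣m'∣
      j<k : j < k
      j<k = <-trans (n<1+n j) 1+j<k
      m'!≡ : ∀ j → j < k → m' ! j ≡ s ! (i + j) ∸ i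
      m'!≡ j j<k = trans (m'!-m j j<k) (cong (_∸ i) (sym (s!-m j j<k)))

    m'-score : Score k m'
    m'-score = score (length-map (_∸ i) m) m'-nondecreasing
      (λ r 1+r<k → Equivalence.to (landau-m⇔ i≤m (total τ) (suc r) (<⇒≤ 1+r<k))
        (Score-landau≤ σ (i + suc r) (+-monoʳ-≤ i (≤-trans (<⇒≤ 1+r<k) (m≤m+n k i)))))
      (Equivalence.to (total⇔ i≤m (total τ) (t-bounded τ) w≡dual) (total σ))

    m'-selfComp : SelfComp k m'
    m'-selfComp j 2[1+j]≤k = begin
      m' ! (k ∸ 1 ∸ j)                ≡⟨ m'!-m (k ∸ 1 ∸ j) mirror<k ⟩
      m ! (k ∸ 1 ∸ j) ∸ i             ≡⟨ cong (_∸ i) (s!-m (k ∸ 1 ∸ j) mirror<k) ⟨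
      s ! (i + (k ∸ 1 ∸ j)) ∸ i       ≡⟨ cong (λ x → s ! x ∸ i) (middle-index i k j<k) ⟨
      s ! (n ∸ 1 ∸ (i + j)) ∸ i       ≡⟨ cong (_∸ i) (sc (i + j) (Equivalence.from (middle-half i k j) 2[1+j]≤k)) ⟩
      (n ∸ 1) ∸ s ! (i + j) ∸ i       ≡⟨ cong₂ (λ x y → x ∸ y ∸ i) (pred[i+[k+i]] i 0<k) (s!-m j j<k) ⟩
      (k ∸ 1 + i + i) ∸ m ! j ∸ i     ≡⟨ unshift-complement (k ∸ 1) i (m ! j) (All⇒! m i≤m j j<k) ⟩
      (k ∸ 1) ∸ (m ! j ∸ i)           ≡⟨ cong ((k ∸ 1) ∸_) (m'!-m j j<k) ⟨
      (k ∸ 1) ∸ m' ! j                ∎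
      where
      open ≡-Reasoning
      j<k : j < k
      j<k = ≤-trans (m≤m+n (suc j) (suc j)) 2[1+j]≤k
      0<k : 0 < k
      0<k = ≤-<-trans z≤n j<k
      mirror<k : k ∸ 1 ∸ j < k
      mirror<k = middle-mirror< j<k

  module Backward (τ : Score i t) (i≤m : All (i ≤_) m) (μ : Score k m') (scm : SelfComp k m') (w≡dual : w ≡ dual n t) where

    w!≡ : ∀ j → j < i → w ! j ≡ (n ∸ 1) ∸ t ! (i ∸ suc j)
    w!≡ j j<i = trans (cong (_! j) w≡dual) (!-dual n t j<i)

    k+i≤w!0 : 0 < length w → k + i ≤ w ! 0
    k+i≤w!0 _ = subst (k + i ≤_) (sym (w!≡ 0 0<i)) (k+i≤pred∸ i k 0<i (Score-entry≤ τ (i ∸ 1) (∸-mirror< 0 0<i)))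

    k-1+i≤n-1 : 0 < k → k ∸ 1 + i ≤ n ∸ 1
    k-1+i≤n-1 0<k = ≤-trans (m≤m+n _ i) (≤-reflexive (sym (pred[i+[k+i]] i 0<k)))

    s-selfComp-t : ∀ j → j < i → s ! (n ∸ 1 ∸ j) ≡ (n ∸ 1) ∸ s ! j
    s-selfComp-t j j<i = begin
      s ! (n ∸ 1 ∸ j)                      ≡⟨ cong (s !_) (tail-index i k j<i) ⟩
      s ! (i + (k + (i ∸ suc j)))          ≡⟨ s!-w (i ∸ suc j) ⟩
      w ! (i ∸ suc j)                      ≡⟨ w!≡ (i ∸ suc j) (∸-mirror< j 0<i) ⟩
      (n ∸ 1) ∸ t ! (i ∸ suc (i ∸ suc j))  ≡⟨ cong (λ x → (n ∸ 1) ∸ t ! x) (∸-mirror j<i) ⟩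
      (n ∸ 1) ∸ t ! j                      ≡⟨ cong ((n ∸ 1) ∸_) (s!-t j j<i) ⟨
      (n ∸ 1) ∸ s ! j                      ∎
      where open ≡-Reasoning

    s-selfComp-m : ∀ j → suc j + suc j ≤ k → s ! (n ∸ 1 ∸ (i + j)) ≡ (n ∸ 1) ∸ s ! (i + j)
    s-selfComp-m j 2[1+j]≤k = begin
      s ! (n ∸ 1 ∸ (i + j))            ≡⟨ cong (s !_) (middle-index i k j<k) ⟩
      s ! (i + (k ∸ 1 ∸ j))            ≡⟨ s!-m (k ∸ 1 ∸ j) mirror<k ⟩
      m ! (k ∸ 1 ∸ j)                  ≡⟨ m!-m' i≤m (k ∸ 1 ∸ j) mirror<k ⟩
      m' ! (k ∸ 1 ∸ j) + i             ≡⟨ cong (_+ i) (scm j 2[1+j]≤k) ⟩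
      (k ∸ 1) ∸ m' ! j + i             ≡⟨ shift-complement (k ∸ 1) i (m' ! j) (Score-entry≤ μ j j<k) ⟨
      (k ∸ 1 + i + i) ∸ (m' ! j + i)   ≡⟨ cong₂ _∸_ (pred[i+[k+i]] i 0<k) (m!-m' i≤m j j<k) ⟨
      (n ∸ 1) ∸ m ! j                  ≡⟨ cong ((n ∸ 1) ∸_) (s!-m j j<k) ⟨
      (n ∸ 1) ∸ s ! (i + j)            ∎
      where
      open ≡-Reasoning
      j<k : j < k
      j<k = ≤-trans (m≤m+n (suc j) (suc j)) 2[1+j]≤k
      0<k : 0 < k
      0<k = ≤-<-trans z≤n j<k
      mirror<k : k ∸ 1 ∸ j < k
      mirror<k = middle-mirror< j<k

    s-selfComp : SelfComp n s
    s-selfComp j 2[1+j]≤n with j <? i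
    ... | yes j<i = s-selfComp-t j j<i
    ... | no  j≮i = subst (λ x → s ! (n ∸ 1 ∸ x) ≡ (n ∸ 1) ∸ s ! x) i+[j∸i]≡j
      (s-selfComp-m (j ∸ i) (Equivalence.to (middle-half i k (j ∸ i))
        (subst (λ x → suc x + suc x ≤ n) (sym i+[j∸i]≡j) 2[1+j]≤n)))
      where
      i+[j∸i]≡j : i + (j ∸ i) ≡ j
      i+[j∸i]≡j = m+[n∸m]≡n (≮⇒≥ j≮i)

    s-entry≤ : ∀ j → j < n → s ! j ≤ n ∸ 1
    s-entry≤ j j<n = All⇒! s (++⁺ t≤ (++⁺ m≤ w≤)) j (subst (j <_) (sym length-s) j<n)
      where
      t≤ : All (_≤ n ∸ 1) t
      t≤ = !⇒All t (t-bounded τ)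
      m≤ : All (_≤ n ∸ 1) m
      m≤ = !⇒All m (λ j j<k → subst (_≤ n ∸ 1) (sym (m!-m' i≤m j j<k))
        (≤-trans (+-monoˡ-≤ i (Score-entry≤ μ j j<k)) (k-1+i≤n-1 (≤-<-trans z≤n j<k))))
      w≤ : All (_≤ n ∸ 1) w
      w≤ = !⇒All w (λ j j<∣w∣ → subst (_≤ n ∸ 1) (sym (w!≡ j (subst (j <_) ∣w∣≡∣t∣ j<∣w∣))) (m∸n≤m (n ∸ 1) (t ! (i ∸ suc j))))

    s-nondecreasing : Nondecreasing s
    s-nondecreasing = Nondecreasing-++ t (m ++ w) (nondecreasing τ) (Nondecreasing-++ m w m-nd w-nd m≤w) t≤mw
      where
      m-nd : Nondecreasing m
      m-nd j 1+j<k = subst₂ _≤_ (sym (m!-m' i≤m j (<-trans (n<1+n j) 1+j<k))) (sym (m!-m' i≤m (suc j) 1+j<k))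
        (+-monoˡ-≤ i (nondecreasing μ j (subst (suc j <_) (sym (length≡ μ)) 1+j<k)))
      w-nd : Nondecreasing w
      w-nd j 1+j<∣w∣ = subst₂ _≤_ (sym (w!≡ j (<-trans (n<1+n j) 1+j<i))) (sym (w!≡ (suc j) 1+j<i))
        (∸-monoʳ-≤ (n ∸ 1) (Nondecreasing-≤ t (nondecreasing τ) (∸-monoʳ-≤ i (n≤1+n (suc j))) (∸-mirror< j 0<i)))
        where
        1+j<i : suc j < i
        1+j<i = subst (suc j <_) ∣w∣≡∣t∣ 1+j<∣w∣
      m≤w : ∀ j → suc j ≡ length m → 0 < length w → m ! j ≤ w ! 0
      m≤w j 1+j≡k 0<∣w∣ = ≤-trans (≤-reflexive (m!-m' i≤m j j<k))
        (≤-trans (+-monoˡ-≤ i (≤-trans (Score-entry≤ μ j j<k) (m∸n≤m k 1))) (k+i≤w!0 0<∣w∣))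
        where
        j<k : j < k
        j<k = ≤-reflexive 1+j≡k
      i≤mw : 0 < length (m ++ w) → i ≤ (m ++ w) ! 0
      i≤mw = All-head-++ m w i≤m (λ 0<∣w∣ → ≤-trans (m≤n+m i k) (k+i≤w!0 0<∣w∣))
      t≤mw : ∀ j → suc j ≡ length t → 0 < length (m ++ w) → t ! j ≤ (m ++ w) ! 0
      t≤mw j 1+j≡i 0< = ≤-trans (Score-entry≤ τ j (≤-reflexive 1+j≡i)) (≤-trans (m∸n≤m i 1) (i≤mw 0<))

    s-total : psum s n ≡ C₂ n
    s-total = Equivalence.from (total⇔ i≤m (total τ) (t-bounded τ) w≡dual) (total μ)

    landau-≤i+k : ∀ R → R ≤ i + k → C₂ R ≤ psum s R
    landau-≤i+k R R≤i+k with R ≤? i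
    ... | yes R≤i = subst (C₂ R ≤_) (sym (psum-s-t R R≤i)) (Score-landau≤ τ R R≤i)
    ... | no  R≰i = subst (λ x → C₂ x ≤ psum s x) i+r≡R
      (Equivalence.from (landau-m⇔ i≤m (total τ) r r≤k) (Score-landau≤ μ r r≤k))
      where
      r = R ∸ i
      i+r≡R : i + r ≡ R
      i+r≡R = m+[n∸m]≡n (<⇒≤ (≰⇒> R≰i))
      r≤k : r ≤ k
      r≤k = subst (r ≤_) (m+n∸m≡n i k) (∸-monoˡ-≤ i R≤i+k)

    s-score : Score n s
    s-score = score length-s s-nondecreasing
      (landau-from-half {n} {s} s-selfComp s-entry≤ s-total (λ r h → landau-≤i+k (suc r) (half⇒<i+k i k r h)))
      s-total

  take-i-s : take i s ≡ t
  take-i-s = take-length-++ t (m ++ w)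

  Glued Pieces : Set
  Glued  = (IsScoreSeq n s × IsSelfComp n s) × (IsScoreSeq i (take i s) × IsStrong i (take i s))
  Pieces = (IsScoreSeq i t × IsStrong i t) × ((All (i ≤_) m × (IsScoreSeq k m' × IsSelfComp k m')) × w ≡ dual n t)

  glued→pieces : Glued → Pieces
  glued→pieces ((isScore , isSC) , prefix) with subst (λ u → IsScoreSeq i u × IsStrong i u) take-i-s prefix
  ... | isScoreT , isStrongT =
    (isScoreT , isStrongT) ,
    ((i≤m , Equivalence.from (IsScoreSeq⇔Score k m') m'-score , Equivalence.from (IsSelfComp⇔SelfComp k m') m'-selfComp) ,
     w≡dual)
    where
    open Forward (Equivalence.to (IsScoreSeq⇔Score n s) isScore) (Equivalence.to (IsSelfComp⇔SelfComp n s) isSC)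
                 (Equivalence.to (IsScoreSeq⇔Score i t) isScoreT)

  pieces→glued : Pieces → Glued
  pieces→glued (strongT@(isScoreT , _) , ((i≤m , isScoreM , isSCM) , w≡dual)) =
    (Equivalence.from (IsScoreSeq⇔Score n s) s-score , Equivalence.from (IsSelfComp⇔SelfComp n s) s-selfComp) ,
    subst (λ u → IsScoreSeq i u × IsStrong i u) (sym take-i-s) strongT
    where
    open Backward (Equivalence.to (IsScoreSeq⇔Score i t) isScoreT) i≤m (Equivalence.to (IsScoreSeq⇔Score k m') isScoreM)
                  (Equivalence.to (IsSelfComp⇔SelfComp k m') isSCM) w≡dual

  𝟙-glue : 𝟙 (selfCompScore? n s ×-dec strongScore? i (take i s))
         ≡ 𝟙 (strongScore? i t) * ((𝟙 (all? (i ≤?_) m) * 𝟙 (selfCompScore? k m')) * 𝟙 (w ≟ₗ dual n t))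
  𝟙-glue = begin
    𝟙 (selfCompScore? n s ×-dec strongScore? i (take i s))
      ≡⟨ 𝟙-cong (mk⇔ glued→pieces pieces→glued) _ (strongScore? i t ×-dec (middle? ×-dec w ≟ₗ dual n t)) ⟩
    𝟙 (strongScore? i t ×-dec (middle? ×-dec w ≟ₗ dual n t))
      ≡⟨ 𝟙-× (strongScore? i t) _ ⟩
    𝟙 (strongScore? i t) * 𝟙 (middle? ×-dec w ≟ₗ dual n t)
      ≡⟨ cong (𝟙 (strongScore? i t) *_) (trans (𝟙-× middle? (w ≟ₗ dual n t)) (cong (_* 𝟙 (w ≟ₗ dual n t)) (𝟙-× (all? (i ≤?_) m) (selfCompScore? k m')))) ⟩
    𝟙 (strongScore? i t) * ((𝟙 (all? (i ≤?_) m) * 𝟙 (selfCompScore? k m')) * 𝟙 (w ≟ₗ dual n t)) ∎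
    where
    open ≡-Reasoning
    middle? : Dec (All (i ≤_) m × (IsScoreSeq k m' × IsSelfComp k m'))
    middle? = all? (i ≤?_) m ×-dec selfCompScore? k m'

𝟙-glue : ∀ i k (t m w : List ℕ) → length t ≡ i → length m ≡ k → length w ≡ i → 0 < i →
  𝟙 (selfCompScore? (i + (k + i)) (t ++ (m ++ w)) ×-dec strongScore? i (take i (t ++ (m ++ w))))
  ≡ 𝟙 (strongScore? i t) * ((𝟙 (all? (i ≤?_) m) * 𝟙 (selfCompScore? k (map (_∸ i) m))) * 𝟙 (w ≟ₗ dual (i + (k + i)) t))
𝟙-glue .(length t) .(length m) t m w refl refl ∣w∣≡∣t∣ 0<i = Glue.𝟙-glue t m w ∣w∣≡∣t∣ 0<i

count-lists : ∀ {Q : List ℕ → Set} (Q? : ∀ s → Dec (Q s)) n B → n C 2 ≤ B → (∀ {s} → Q s → IsScoreSeq n s) →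
  ∑ (𝟙 ∘ Q?) (lists B n) ≡ length (filter Q? (candidates n))
count-lists Q? n B n₂≤B Q⇒score = trans (∑-lists-shrink B (n C 2) n n₂≤B (𝟙 ∘ Q?) outside)
  (sym (length-filter≡∑𝟙 Q? (candidates n)))
  where
  outside : ∀ s → ¬ All (_≤ n C 2) s → 𝟙 (Q? s) ≡ 0
  outside s unbounded = 𝟙-no (λ q → unbounded (subst (λ x → All (_≤ x) s) (sym (C2≡C₂ n))
    (Score-All≤ (Equivalence.to (IsScoreSeq⇔Score n s) (Q⇒score q))))) (Q? s)

count-strongPrefix : ∀ {n} i k → 0 < i → i + (k + i) ≡ n →
  ∑ (λ s → 𝟙 (selfCompScore? n s ×-dec strongScore? i (take i s))) (candidates n) ≡ SS i * SCS k
count-strongPrefix i k 0<i refl = begin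
  ∑ F (lists B n)                                                                        ≡⟨ ∑-lists-++ B i (k + i) F ⟩
  ∑ (λ t → ∑ (λ v → F (t ++ v)) (lists B (k + i))) (lists B i)                           ≡⟨ ∑-cong (λ t → ∑-lists-++ B k i (λ v → F (t ++ v))) (lists B i) ⟩
  ∑ (λ t → ∑ (λ m → ∑ (λ w → F (t ++ (m ++ w))) (lists B i)) (lists B k)) (lists B i)
    ≡⟨ ∑-lists-cong B i (λ t ∣t∣ _ → ∑-lists-cong B k (λ m ∣m∣ _ → ∑-lists-cong B i (λ w ∣w∣ _ → 𝟙-glue i k t m w ∣t∣ ∣m∣ ∣w∣ 0<i))) ⟩
  ∑ (λ t → ∑ (λ m → ∑ (λ w → T t * (M m * W t w)) (lists B i)) (lists B k)) (lists B i)  ≡⟨ ∑-lists-cong B i (λ t ∣t∣ _ → sum-m-w t ∣t∣) ⟩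
  ∑ (λ t → T t * ∑ M (lists B k)) (lists B i)                                            ≡⟨ ∑-*ʳ _ T (lists B i) ⟩
  ∑ T (lists B i) * ∑ M (lists B k)                                                      ≡⟨ cong₂ _*_ count-t count-m ⟩
  SS i * SCS k                                                                           ∎
  where
  open ≡-Reasoning
  n B : ℕ
  n = i + (k + i)
  B = n C 2
  F : List ℕ → ℕ
  F s = 𝟙 (selfCompScore? n s ×-dec strongScore? i (take i s))
  T M : List ℕ → ℕ
  T t = 𝟙 (strongScore? i t)
  M m = 𝟙 (all? (i ≤?_) m) * 𝟙 (selfCompScore? k (map (_∸ i) m))
  W : List ℕ → List ℕ → ℕ
  W t w = 𝟙 (w ≟ₗ dual n t)
  B≡C₂n : B ≡ C₂ n
  B≡C₂n = C2≡C₂ n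
  C₂k+i≤B : C₂ k + i ≤ B
  C₂k+i≤B = subst (C₂ k + i ≤_) (sym B≡C₂n) (C₂-+-≤-C₂-sandwich i k 0<i)
  sum-m-w : ∀ t → length t ≡ i → ∑ (λ m → ∑ (λ w → T t * (M m * W t w)) (lists B i)) (lists B k) ≡ T t * ∑ M (lists B k)
  sum-m-w t ∣t∣≡i = trans (∑-cong (λ m → begin
      ∑ (λ w → T t * (M m * W t w)) (lists B i)  ≡⟨ ∑-*ˡ (T t) _ (lists B i) ⟩
      T t * ∑ (λ w → M m * W t w) (lists B i)    ≡⟨ cong (T t *_) (∑-*ˡ (M m) (W t) (lists B i)) ⟩
      T t * (M m * ∑ (W t) (lists B i))          ≡⟨ cong (λ x → T t * (M m * x)) (∑-lists-≡ B i (dual n t) ∣dual∣≡i dual≤B) ⟩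
      T t * (M m * 1)                            ≡⟨ cong (T t *_) (*-identityʳ (M m)) ⟩
      T t * M m                                  ∎) (lists B k))
    (∑-*ˡ (T t) M (lists B k))
    where
    ∣dual∣≡i : length (dual n t) ≡ i
    ∣dual∣≡i = trans (length-dual n t) ∣t∣≡i
    dual≤B : All (_≤ B) (dual n t)
    dual≤B = dual-All≤ n t (subst (n ∸ 1 ≤_) (sym B≡C₂n) (pred≤C₂ n))
  count-t : ∑ T (lists B i) ≡ SS i
  count-t = count-lists (strongScore? i) i B (subst₂ _≤_ (sym (C2≡C₂ i)) (sym B≡C₂n) (C₂-mono (m≤m+n i (k + i)))) proj₁
  count-m : ∑ M (lists B k) ≡ SCS k
  count-m = trans (∑-lists-translate B i k (m+n≤o⇒n≤o (C₂ k) C₂k+i≤B) (𝟙 ∘ selfCompScore? k))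
    (count-lists (selfCompScore? k) k (B ∸ i) (subst (_≤ B ∸ i) (sym (C2≡C₂ k)) (m+n≤o⇒m≤o∸n (C₂ k) C₂k+i≤B)) proj₁)

strongSelfCompScore? : ∀ n s → Dec (IsScoreSeq n s × IsStrong n s × IsSelfComp n s)
strongSelfCompScore? n s = isScoreSeq? n s ×-dec isStrong? n s ×-dec isSelfComp? n s

𝟙-selfCompScore-split : ∀ n s → 𝟙 (selfCompScore? n s) ≡
  𝟙 (strongSelfCompScore? n s) + ∑[ i < n / 2 ] 𝟙 (selfCompScore? n s ×-dec strongScore? (suc i) (take (suc i) s))
𝟙-selfCompScore-split n s with selfCompScore? n s
... | no ¬sc = sym (cong₂ _+_ (𝟙-no (λ (isScore , _ , isSC) → ¬sc (isScore , isSC)) (strongSelfCompScore? n s))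
                             (∑<-zero _ (n / 2) (λ _ _ → refl)))
... | yes (isScore , isSC) = sym (begin
  𝟙 (strongSelfCompScore? n s) + ∑[ i < n / 2 ] 𝟙 (yes (isScore , isSC) ×-dec prefix? i)
    ≡⟨ cong₂ _+_ (𝟙-cong (mk⇔ (λ (_ , st , _) → st) (λ st → isScore , st , isSC)) _ (isStrong? n s))
                 (∑<-cong (n / 2) (λ i _ → trans (𝟙-× (yes (isScore , isSC)) (prefix? i)) (+-identityʳ _))) ⟩
  𝟙 (isStrong? n s) + ∑[ i < n / 2 ] 𝟙 (prefix? i)
    ≡⟨ strong⊎strongPrefix (Equivalence.to (IsScoreSeq⇔Score n s) isScore) (Equivalence.to (IsSelfComp⇔SelfComp n s) isSC) ⟩
  1 ∎)
  where
  open ≡-Reasoning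
  prefix? : ∀ i → Dec (IsScoreSeq (suc i) (take (suc i) s) × IsStrong (suc i) (take (suc i) s))
  prefix? i = strongScore? (suc i) (take (suc i) s)

split-off-twice : ∀ {i n} → i + i ≤ n → i + (n ∸ 2 * i + i) ≡ n
split-off-twice {i} {n} i+i≤n = trans (lemma i (n ∸ 2 * i)) (trans (cong (λ x → n ∸ x + (i + i)) (double i)) (m∸n+n≡m i+i≤n))
  where
  lemma : ∀ i x → i + (x + i) ≡ x + (i + i)
  lemma = solve-∀
  double : ∀ i → 2 * i ≡ i + i
  double = solve-∀

theorem13 : (n : ℕ) → 1 ≤ n →
    SSCS n + sum (map (λ i → SS i * SCS (n ∸ 2 * i)) (map suc (upTo (n / 2)))) ≡ SCS n
theorem13 n _ = sym (begin
  SCS n                                                        ≡⟨ length-filter≡∑𝟙 (selfCompScore? n) (candidates n) ⟩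
  ∑ (𝟙 ∘ selfCompScore? n) (candidates n)                      ≡⟨ ∑-cong (𝟙-selfCompScore-split n) (candidates n) ⟩
  ∑ (λ s → 𝟙 (strongSelfCompScore? n s) + ∑[ i < n / 2 ] G i s) (candidates n)
                                                               ≡⟨ ∑-+ _ _ (candidates n) ⟩
  ∑ (𝟙 ∘ strongSelfCompScore? n) (candidates n) + ∑ (λ s → ∑[ i < n / 2 ] G i s) (candidates n)
                                                               ≡⟨ cong₂ _+_ (sym (length-filter≡∑𝟙 (strongSelfCompScore? n) (candidates n)))
                                                                            (∑-∑< G (n / 2) (candidates n)) ⟩
  SSCS n + ∑[ i < n / 2 ] ∑ (G i) (candidates n)               ≡⟨ cong (SSCS n +_) (∑<-cong (n / 2) count) ⟩
  SSCS n + ∑[ i < n / 2 ] H (suc i)                            ≡⟨ cong (SSCS n +_) (trans (∑-map H suc (upTo (n / 2))) (∑-applyUpTo (H ∘ suc) id (n / 2))) ⟨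
  SSCS n + sum (map H (map suc (upTo (n / 2))))                ∎)
  where
  open ≡-Reasoning
  G : ℕ → List ℕ → ℕ
  G i s = 𝟙 (selfCompScore? n s ×-dec strongScore? (suc i) (take (suc i) s))
  H : ℕ → ℕ
  H i = SS i * SCS (n ∸ 2 * i)
  count : ∀ i → i < n / 2 → ∑ (G i) (candidates n) ≡ H (suc i)
  count i i<n/2 = count-strongPrefix {n} (suc i) (n ∸ 2 * suc i) (s≤s z≤n) (split-off-twice {suc i} (<n/2⇒ i<n/2))
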